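{- Let $k\ge3$, let $B$ be an integer-valued $\ell\times k$ matrix of full rank $\ell$ which is irredundant, satisfies $(*)$ and is strictly balanced, and let $b'$ be an integer vector with $(B,b')$ irredundant. Let $X\subseteq[n]$ (e.g. a realisation of $[n]_p$) and let $H$ be the $k$-uniform hypergraph with vertex set $X$ whose edges are the sets $\{x_1,\dots,x_k\}$ for all $k$-distinct solutions $(x_1,\dots,x_k)\in X^k$ of $Bx=b'$. Let $H'$ be a connected component of $H$ which has an edge order $e_0,\dots,e_t$ such that there exists $a\in\{0,\dots,t\}$ with $e_i$ good for all $i\in\{a+1,\dots,t\}$ and precisely one of the following holds: (i) $a=0$; (ii) $a\ge2$ and $e_0,\dots,e_a$ forms a loose cycle; (iii) $a=1$ and $e_0,e_1$ forms an overlapping pair; (iv) $a=3$, $k=3$ and $e_0,\dots,e_3$ forms a Pasch configuration; (v) $a\ge3$ is odd and $e_0,\dots,e_a$ forms a $(k,(a+1)/2,2)$-star; (vi) $a\ge2$ and $e_0,\dots,e_a$ forms a $(k,a+1,d)$-link with $d\le\lfloor k/a\rfloor$. Then Breaker has a winning strategy in the Maker-Breaker game played on $H'$.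
   Context: A solution is $k$-distinct if its entries are pairwise distinct; $(B,b')$ is irredundant if a $k$-distinct solution exists in $\mathbb{N}$, $B$ irredundant if $(B,0)$ is; $(*)$: under Gaussian elimination no row of $B$ consists of precisely two non-zero rational entries; $B$ strictly balanced: for all $W\subseteq[k]$ with $2\le|W|<k$, $\frac{|W|-1}{|W|-1+\mathrm{rank}(B_{\overline W})-\ell}<\frac{k-1}{k-1-\ell}$, where $B_{\overline W}$ consists of the columns not indexed by $W$. The Maker-Breaker game on a hypergraph: players alternately claim unclaimed vertices (Maker first); Maker wins if she claims all vertices of some edge, otherwise Breaker wins. An edge order is an enumeration of the edges. In a sequence $g_1,\dots,g_u$ of edges, a vertex of $g_i$ is new in $g_i$ if it is in no earlier $g_j$, old otherwise; $g_i$ ($i\ge 2$) is good if it has exactly one old vertex, bad if it has $2$ to $k-1$ old vertices, $k$-bad if it has $k$ old vertices; the sequence is allowed if each $g_i$, $i\ge2$, is good, bad or $k$-bad, and valid if each is good or bad. For a valid sequence with consecutive edges intersecting: overlapping pair: $u=2$, $2\le|g_1\cap g_2|\le k-1$; loose cycle: $u\ge3$, $|g_i\cap g_j|=1$ if $j=i+1$ or $(i,j)=(1,u)$, and $0$ otherwise ($i<j$). For an allowed sequence: Pasch configuration: $k=3$, $u=4$, six vertices each lying in exactly two edges (one per pair of edges); $k$-uniform loose $u$-star: edges pairwise disjoint except for one common central vertex; $(k,u/2,2)$-star: the $u$ edges form two loose $(u/2)$-stars $S_1,S_2$ with a bijection $f$ such that $e$ and $f(e)$ share all their vertices except the two central vertices;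 $(k,u,a)$-link: the edges contain $k+a$ vertices in total and any two edges together contain all of them. -}

module Defs where

open import Data.Nat as ℕ using (ℕ; zero; suc; _≤_; _<_; _∸_)
open import Data.Nat.DivMod using (_/_)
open import Data.Integer as ℤ using (ℤ; +_; -[1+_])
open import Data.Rational as ℚ using (ℚ; 0ℚ)
open import Data.Fin using (Fin; toℕ; inject≤)
open import Data.Fin.Subset using (Subset; ⁅_⁆; _∈_; _∉_; _⊆_; _∪_; _∩_; ∁; ∣_∣; ⊤; ⊥)
open import Data.Bool using (if_then_else_)
open import Data.Nat using (_<ᵇ_)
open import Data.Product using (Σ; _×_; _,_)
open import Data.Sum using (_⊎_)
open import Data.Unit using () renaming (⊤ to Unit)
open import Data.Empty using () renaming (⊥ to Empty)
open import Data.List using (List; []; _∷_)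
open import Function.Definitions using (Injective)
open import Relation.Nullary using (¬_)
open import Relation.Binary.PropositionalEquality using (_≡_; _≢_)
open import Relation.Binary.Construct.Closure.ReflexiveTransitive using (Star)

sumℤ : ∀ {m} → (Fin m → ℤ) → ℤ
sumℤ {zero}  f = + 0
sumℤ {suc m} f = f Data.Fin.zero ℤ.+ sumℤ (λ j → f (Data.Fin.suc j))

sumℚ : ∀ {m} → (Fin m → ℚ) → ℚ
sumℚ {zero}  f = 0ℚ
sumℚ {suc m} f = f Data.Fin.zero ℚ.+ sumℚ (λ j → f (Data.Fin.suc j))

toℚ : ℤ → ℚ
toℚ z = z ℚ./ 1

-- the rational number p / q for an integer q (junk value 0 when q = 0;
-- always used under a hypothesis q ≢ 0)
ratio : ℤ → ℤ → ℚ
ratio p (+ zero)  = 0ℚ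
ratio p (+ suc q) = p ℚ./ suc q
ratio p -[1+ q ]  = (ℤ.- p) ℚ./ suc q

-- ⌊ m / a ⌋ (junk value 0 for a = 0; always used with a ≥ 2)
floorDiv : ℕ → ℕ → ℕ
floorDiv m zero    = 0
floorDiv m (suc a) = m / suc a

bigUnion : ∀ {n m} → (Fin m → Subset n) → Subset n
bigUnion {m = zero}  f = ⊥
bigUnion {m = suc m} f = f Data.Fin.zero ∪ bigUnion (λ j → f (Data.Fin.suc j))

NoneOf : List Set → Set
NoneOf []       = Unit
NoneOf (P ∷ Ps) = ¬ P × NoneOf Ps

ExactlyOne : List Set → Set
ExactlyOne []       = Empty
ExactlyOne (P ∷ Ps) = (P × NoneOf Ps) ⊎ (¬ P × ExactlyOne Ps)

Matrix : ℕ → ℕ → Set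
Matrix ℓ k = Fin ℓ → Fin k → ℤ

IsSolution : ∀ {ℓ k} → Matrix ℓ k → (Fin ℓ → ℤ) → (Fin k → ℕ) → Set
IsSolution B b' x = ∀ i → sumℤ (λ j → B i j ℤ.* + x j) ≡ b' i

Distinct : ∀ {k} → (Fin k → ℕ) → Set
Distinct x = Injective _≡_ _≡_ x

IrredundantPair : ∀ {ℓ k} → Matrix ℓ k → (Fin ℓ → ℤ) → Set
IrredundantPair {k = k} B b' =
  Σ (Fin k → ℕ) λ x → (∀ j → 1 ≤ x j) × Distinct x × IsSolution B b' x

Irredundant : ∀ {ℓ k} → Matrix ℓ k → Set
Irredundant B = IrredundantPair B (λ _ → + 0)

LinIndepCols : ∀ {ℓ k} → Matrix ℓ k → Subset k → Set
LinIndepCols {k = k} B S =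
  (c : Fin k → ℚ) → (∀ j → j ∉ S → c j ≡ 0ℚ) →
  (∀ i → sumℚ (λ j → c j ℚ.* toℚ (B i j)) ≡ 0ℚ) → ∀ j → c j ≡ 0ℚ

RankCols : ∀ {ℓ k} → Matrix ℓ k → Subset k → ℕ → Set
RankCols {k = k} B T r =
  Σ (Subset k) (λ S → S ⊆ T × ∣ S ∣ ≡ r × LinIndepCols B S)
  × (∀ S → S ⊆ T → LinIndepCols B S → ∣ S ∣ ≤ r)

Rank : ∀ {ℓ k} → Matrix ℓ k → ℕ → Set
Rank B r = RankCols B ⊤ r

ExactlyTwoNonzero : ∀ {k} → (Fin k → ℚ) → Set
ExactlyTwoNonzero {k} v =
  Σ (Fin k) λ j₁ → Σ (Fin k) λ j₂ → j₁ ≢ j₂ × v j₁ ≢ 0ℚ × v j₂ ≢ 0ℚ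
    × (∀ j → j ≢ j₁ → j ≢ j₂ → v j ≡ 0ℚ)

-- condition (*): no row obtainable by Gaussian elimination, i.e. no vector
-- of the ℚ-row space of B, has precisely two non-zero entries
StarCondition : ∀ {ℓ k} → Matrix ℓ k → Set
StarCondition {ℓ} {k} B =
  (y : Fin ℓ → ℚ) → ¬ ExactlyTwoNonzero (λ j → sumℚ (λ i → y i ℚ.* toℚ (B i j)))

StrictlyBalanced : ∀ {ℓ k} → Matrix ℓ k → Set
StrictlyBalanced {ℓ} {k} B =
  (W : Subset k) → 2 ≤ ∣ W ∣ → ∣ W ∣ < k → (r : ℕ) → RankCols B (∁ W) r →
  let D = + (∣ W ∣ ∸ 1) ℤ.+ + r ℤ.- + ℓ
      E = + (k ∸ 1) ℤ.- + ℓ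
  in D ≢ + 0 × E ≢ + 0 × (ratio (+ (∣ W ∣ ∸ 1)) D ℚ.< ratio (+ (k ∸ 1)) E)

-- The hypergraph H on X ⊆ [n].  The element j : Fin n stands for the
-- integer toℕ j + 1, so Fin n represents [n] = {1,…,n}.

val : ∀ {n} → Fin n → ℕ
val j = suc (toℕ j)

image : ∀ {n k} → (Fin k → Fin n) → Subset n
image x = bigUnion (λ j → ⁅ x j ⁆)

EdgeH : ∀ {ℓ k} → Matrix ℓ k → (Fin ℓ → ℤ) → (n : ℕ) → Subset n → Subset n → Set
EdgeH {k = k} B b' n X e =
  Σ (Fin k → Fin n) λ x → (∀ j → x j ∈ X) × Injective _≡_ _≡_ x
    × IsSolution B b' (λ j → val (x j)) × e ≡ image x

AdjacentH : ∀ {ℓ k} → Matrix ℓ k → (Fin ℓ → ℤ) → (n : ℕ) → Subset n → Fin n → Fin n → Set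
AdjacentH B b' n X u w = Σ (Subset _) λ e → EdgeH B b' n X e × u ∈ e × w ∈ e

CompVertex : ∀ {ℓ k} → Matrix ℓ k → (Fin ℓ → ℤ) → (n : ℕ) → Subset n → Fin n → Fin n → Set
CompVertex B b' n X v u = u ∈ X × Star (AdjacentH B b' n X) v u

CompEdge : ∀ {ℓ k} → Matrix ℓ k → (Fin ℓ → ℤ) → (n : ℕ) → Subset n → Fin n → Subset n → Set
CompEdge B b' n X v e = EdgeH B b' n X e × (∀ u → u ∈ e → CompVertex B b' n X v u)

-- BreakerWins V E M K : Maker to move, Maker has claimed M,
-- Breaker has claimed K, and Breaker has a strategy guaranteeing that Maker
-- never claims all vertices of an edge.

data BreakerWins {n} (V : Fin n → Set) (E : Subset n → Set) : Subset n → Subset n → Set where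
  breakerWins : ∀ {M K} →
    (∀ u → V u → u ∉ M → u ∉ K →
        (∀ e → E e → ¬ (e ⊆ (⁅ u ⁆ ∪ M)))
      × ((∀ w → V w → w ∈ (⁅ u ⁆ ∪ M) ⊎ w ∈ K)
        ⊎ Σ (Fin n) λ w → V w × w ∉ (⁅ u ⁆ ∪ M) × w ∉ K
            × BreakerWins V E (⁅ u ⁆ ∪ M) (⁅ w ⁆ ∪ K)))
    → BreakerWins V E M K

BreakerHasWinningStrategy : ∀ {n} → (Fin n → Set) → (Subset n → Set) → Set
BreakerHasWinningStrategy V E = BreakerWins V E ⊥ ⊥

-- Sequences of edges g : Fin u → Subset n  (g zero is the first edge g₁)

Earlier : ∀ {n u} → (Fin u → Subset n) → Fin u → Subset n
Earlier g i = bigUnion (λ j → if toℕ j <ᵇ toℕ i then g j else ⊥)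

OldCount : ∀ {n u} → (Fin u → Subset n) → Fin u → ℕ
OldCount g i = ∣ g i ∩ Earlier g i ∣

Good : ∀ {n u} → (Fin u → Subset n) → Fin u → Set
Good g i = OldCount g i ≡ 1

Bad : ∀ {n u} → ℕ → (Fin u → Subset n) → Fin u → Set
Bad k g i = 2 ≤ OldCount g i × OldCount g i ≤ k ∸ 1

KBad : ∀ {n u} → ℕ → (Fin u → Subset n) → Fin u → Set
KBad k g i = OldCount g i ≡ k

Allowed : ∀ {n u} → ℕ → (Fin u → Subset n) → Set
Allowed k g = ∀ i → 1 ≤ toℕ i → Good g i ⊎ Bad k g i ⊎ KBad k g i

Valid : ∀ {n u} → ℕ → (Fin u → Subset n) → Set
Valid k g = ∀ i → 1 ≤ toℕ i → Good g i ⊎ Bad k g i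

ConsecutiveIntersecting : ∀ {n u} → (Fin u → Subset n) → Set
ConsecutiveIntersecting g =
  ∀ i j → toℕ j ≡ suc (toℕ i) → 1 ≤ ∣ g i ∩ g j ∣

OverlappingPair : ∀ {n u} → ℕ → (Fin u → Subset n) → Set
OverlappingPair {u = u} k g =
  Valid k g × ConsecutiveIntersecting g × u ≡ 2
  × (∀ i j → toℕ i < toℕ j → 2 ≤ ∣ g i ∩ g j ∣ × ∣ g i ∩ g j ∣ ≤ k ∸ 1)

LooseCycle : ∀ {n u} → ℕ → (Fin u → Subset n) → Set
LooseCycle {u = u} k g =
  Valid k g × ConsecutiveIntersecting g × 3 ≤ u
  × (∀ i j → toℕ i < toℕ j →
       ((toℕ j ≡ suc (toℕ i) ⊎ (toℕ i ≡ 0 × suc (toℕ j) ≡ u)) → ∣ g i ∩ g j ∣ ≡ 1)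
     × (¬ (toℕ j ≡ suc (toℕ i) ⊎ (toℕ i ≡ 0 × suc (toℕ j) ≡ u)) → ∣ g i ∩ g j ∣ ≡ 0))

Pasch : ∀ {n u} → ℕ → (Fin u → Subset n) → Set
Pasch {n} {u} k g =
  Allowed k g × k ≡ 3 × u ≡ 4 × ∣ bigUnion g ∣ ≡ 6
  × (∀ i j → i ≢ j → ∣ g i ∩ g j ∣ ≡ 1)
  × (∀ (w : Fin n) → w ∈ bigUnion g →
       Σ (Fin u) λ i → Σ (Fin u) λ j → i ≢ j × w ∈ g i × w ∈ g j
         × (∀ m → m ≢ i → m ≢ j → w ∉ g m))

LooseStar : ∀ {n u} → (Fin u → Subset n) → Fin n → Set
LooseStar g c = (∀ i → c ∈ g i) × (∀ i j → i ≢ j → g i ∩ g j ≡ ⁅ c ⁆)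

-- (k, m, 2)-star on 2m edges: two loose m-stars S₁ = g ∘ s₁, S₂ = g ∘ s₂
-- partitioning the edges, with the bijection f (s₁ i) = s₂ i such that e
-- and f(e) share all their vertices except the two centres
DoubleStar : ∀ {n u} → ℕ → ℕ → (Fin u → Subset n) → Set
DoubleStar {n} {u} k m g =
  Allowed k g × u ≡ m ℕ.+ m
  × Σ (Fin m → Fin u) λ s₁ → Σ (Fin m → Fin u) λ s₂ →
      Injective _≡_ _≡_ s₁ × Injective _≡_ _≡_ s₂
      × (∀ i j → s₁ i ≢ s₂ j)
      × (∀ p → Σ (Fin m) (λ i → s₁ i ≡ p) ⊎ Σ (Fin m) (λ i → s₂ i ≡ p))
      × Σ (Fin n) λ c₁ → Σ (Fin n) λ c₂ → c₁ ≢ c₂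
          × LooseStar (λ i → g (s₁ i)) c₁ × LooseStar (λ i → g (s₂ i)) c₂
          × (∀ i → g (s₁ i) ∩ ∁ ⁅ c₁ ⁆ ≡ g (s₂ i) ∩ ∁ ⁅ c₂ ⁆)

Link : ∀ {n u} → ℕ → ℕ → (Fin u → Subset n) → Set
Link k d g =
  Allowed k g × ∣ bigUnion g ∣ ≡ k ℕ.+ d
  × (∀ i j → i ≢ j → g i ∪ g j ≡ bigUnion g)

-- Breaker plays a pairing strategy. Every edge after e_a is good, so (as k ≥ 3) two of its vertices
-- lie in no earlier edge; pairing these two vertices for every such edge gives disjoint pairs that
-- avoid the core e₀, …, e_a. In each core configuration except the Pasch configuration the core
-- edges also carry disjoint pairs, one inside each edge. In the Pasch configuration Breaker waits
-- for Maker's first core vertex u, answers with a vertex r sharing an edge with u, which blocks the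
-- two edges through r, and pairs up the two remaining edges away from u. Answering every paired
-- vertex by its partner, Breaker keeps Maker from completing any edge.

module Submission where

open import Defs
open import Data.Bool using (Bool; true; false; T; if_then_else_)
open import Data.Bool.Properties using (T?)
open import Data.Empty using (⊥-elim)
open import Data.Fin using (Fin; zero; suc; toℕ; fromℕ; inject≤; fromℕ<; _≟_)
open import Data.Fin.Properties
  using (any?; toℕ-injective; toℕ-inject≤; toℕ-fromℕ; toℕ-fromℕ<; toℕ<n)
  renaming (suc-injective to sucᶠ-injective)
open import Data.Vec using (here; there; _∷_; [])
open import Data.Fin.Subset using (Subset; _∈_; _∉_; _⊆_; _∪_; _∩_; ⁅_⁆; ∣_∣; ∁; inside; outside)
import Data.Fin.Subset as Subset
open import Data.Fin.Subset.Properties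
  using (_∈?_; x∈p∪q⁺; x∈p∪q⁻; ∪-identityˡ; x∈p∩q⁺; x∈p∩q⁻; ∣p∩q∣≤∣q∣; ∉⊥; ∣⊥∣≡0; ∣p∣≤n;
         x∈⁅x⁆; x∈⁅y⁆⇒x≡y; x∉⁅y⁆⇒x≢y; x≢y⇒x∉⁅y⁆; ∣⁅x⁆∣≡1; x∉p⇒x∈∁p; x∈∁p⇒x∉p; ∣∁p∣≡n∸∣p∣;
         p⊆q⇒∣p∣≤∣q∣; p⊂q⇒∣p∣<∣q∣; ⊆-antisym)
open import Data.Nat using (ℕ; zero; suc; _+_; _*_; _∸_; _≤_; _<_; z≤n; s≤s; _<ᵇ_)
open import Data.Nat.Properties
  using (≤-trans; ≤-reflexive; ≤-pred; ≤-antisym; <-irrefl; <⇒≱; ≮⇒≥; ≰⇒>; ≤-<-trans; <-≤-trans; <-cmp;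
         _<?_; _≤?_; n<1+n; m≤m+n; m≤n+m; n≢0⇒n>0; suc-injective; <ᵇ⇒<; <⇒<ᵇ;
         +-suc; +-assoc; +-identityʳ; +-monoʳ-≤; +-mono-≤; +-cancelˡ-≡; +-cancelˡ-≤;
         *-comm; *-monoˡ-≤; *-monoʳ-≤; module ≤-Reasoning)
  renaming (_≟_ to _≟ℕ_)
open import Data.Nat.DivMod using (m/n*n≤m)
open import Data.Product using (Σ; ∃-syntax; _×_; _,_; proj₁; proj₂; map₂; swap)
open import Data.Sum using (_⊎_; inj₁; inj₂)
import Data.Sum as Sum
open import Data.List using (List; _∷_; [])
open import Data.Integer using (ℤ)
open import Data.Unit using (⊤; tt)
open import Function using (_∘_; case_of_)
open import Function.Definitions using (Injective)
open import Relation.Binary using (tri<; tri≈; tri>)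
open import Relation.Nullary using (¬_; Dec; yes; no)
open import Relation.Nullary.Decidable using (_×-dec_; _⊎-dec_; ¬?)
open import Relation.Binary.PropositionalEquality
  using (_≡_; _≢_; refl; sym; trans; cong; cong₂; subst; subst₂; module ≡-Reasoning)
open import Relation.Binary.Construct.Closure.ReflexiveTransitive using (Star; ε; _◅_; _◅◅_)

private variable
  n : ℕ
  p q s O M K K′ : Subset n
  u w x y z : Fin n

∈∪ˡ : x ∈ p → x ∈ p ∪ q
∈∪ˡ = x∈p∪q⁺ ∘ inj₁

∈∪ʳ : x ∈ q → x ∈ p ∪ q
∈∪ʳ = x∈p∪q⁺ ∘ inj₂

∈⁅⁆∪⁻ : x ∈ ⁅ u ⁆ ∪ p → x ≡ u ⊎ x ∈ p
∈⁅⁆∪⁻ {u = u} {p = p} m = Sum.map₁ (x∈⁅y⁆⇒x≡y u) (x∈p∪q⁻ ⁅ u ⁆ p m)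

∈∩ : x ∈ p → x ∈ q → x ∈ p ∩ q
∈∩ xp xq = x∈p∩q⁺ (xp , xq)

∈∩ˡ : x ∈ p ∩ q → x ∈ p
∈∩ˡ {p = p} {q = q} = proj₁ ∘ x∈p∩q⁻ p q

∈∩ʳ : x ∈ p ∩ q → x ∈ q
∈∩ʳ {p = p} {q = q} = proj₂ ∘ x∈p∩q⁻ p q

⁅x⁆⊆ : x ∈ p → ⁅ x ⁆ ⊆ p
⁅x⁆⊆ {x = x} xp m rewrite x∈⁅y⁆⇒x≡y x m = xp

x∉p⇒∣⁅x⁆∪p∣≡1+∣p∣ : x ∉ p → ∣ ⁅ x ⁆ ∪ p ∣ ≡ suc ∣ p ∣
x∉p⇒∣⁅x⁆∪p∣≡1+∣p∣ {x = zero}  {p = inside ∷ p}  x∉p = ⊥-elim (x∉p here)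
x∉p⇒∣⁅x⁆∪p∣≡1+∣p∣ {x = zero}  {p = outside ∷ p} x∉p = cong (suc ∘ ∣_∣) (∪-identityˡ p)
x∉p⇒∣⁅x⁆∪p∣≡1+∣p∣ {x = suc x} {p = inside ∷ p}  x∉p = cong suc (x∉p⇒∣⁅x⁆∪p∣≡1+∣p∣ (x∉p ∘ there))
x∉p⇒∣⁅x⁆∪p∣≡1+∣p∣ {x = suc x} {p = outside ∷ p} x∉p = x∉p⇒∣⁅x⁆∪p∣≡1+∣p∣ (x∉p ∘ there)

∣p∪q∣+∣p∩q∣≡∣p∣+∣q∣ : (p q : Subset n) → ∣ p ∪ q ∣ + ∣ p ∩ q ∣ ≡ ∣ p ∣ + ∣ q ∣
∣p∪q∣+∣p∩q∣≡∣p∣+∣q∣ []            []            = refl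
∣p∪q∣+∣p∩q∣≡∣p∣+∣q∣ (inside ∷ p)  (inside ∷ q)  =
  cong suc (trans (+-suc _ _) (trans (cong suc (∣p∪q∣+∣p∩q∣≡∣p∣+∣q∣ p q)) (sym (+-suc _ _))))
∣p∪q∣+∣p∩q∣≡∣p∣+∣q∣ (inside ∷ p)  (outside ∷ q) = cong suc (∣p∪q∣+∣p∩q∣≡∣p∣+∣q∣ p q)
∣p∪q∣+∣p∩q∣≡∣p∣+∣q∣ (outside ∷ p) (inside ∷ q)  =
  trans (cong suc (∣p∪q∣+∣p∩q∣≡∣p∣+∣q∣ p q)) (sym (+-suc _ _))
∣p∪q∣+∣p∩q∣≡∣p∣+∣q∣ (outside ∷ p) (outside ∷ q) = ∣p∪q∣+∣p∩q∣≡∣p∣+∣q∣ p q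

∣p∪q∣≤∣p∣+∣q∣ : (p q : Subset n) → ∣ p ∪ q ∣ ≤ ∣ p ∣ + ∣ q ∣
∣p∪q∣≤∣p∣+∣q∣ p q = ≤-trans (m≤m+n _ _) (≤-reflexive (∣p∪q∣+∣p∩q∣≡∣p∣+∣q∣ p q))

p⊆q∧x∈q∧x∉p⇒∣p∣<∣q∣ : p ⊆ q → x ∈ q → x ∉ p → ∣ p ∣ < ∣ q ∣
p⊆q∧x∈q∧x∉p⇒∣p∣<∣q∣ p⊆q x∈q x∉p = p⊂q⇒∣p∣<∣q∣ (p⊆q , _ , x∈q , x∉p)

∣p∣<∣q∣⇒∃∈q∖p : ∣ p ∣ < ∣ q ∣ → ∃[ x ] x ∈ q × x ∉ p
∣p∣<∣q∣⇒∃∈q∖p {p = p} {q = q} lt with any? (λ x → (x ∈? q) ×-dec ¬? (x ∈? p))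
... | yes found = found
... | no none   = ⊥-elim (<⇒≱ lt (p⊆q⇒∣p∣≤∣q∣ q⊆p))
  where
  q⊆p : q ⊆ p
  q⊆p {x} x∈q with x ∈? p
  ... | yes x∈p = x∈p
  ... | no  x∉p = ⊥-elim (none (x , x∈q , x∉p))

1≤∣p∣⇒∃∈p : 1 ≤ ∣ p ∣ → ∃[ x ] x ∈ p
1≤∣p∣⇒∃∈p {n} {p = p} le with ∣p∣<∣q∣⇒∃∈q∖p {p = Subset.⊥} (subst (_< ∣ p ∣) (sym (∣⊥∣≡0 n)) le)
... | x , x∈p , _ = x , x∈p

2≤∣p∣⇒∃₂∈p : 2 ≤ ∣ p ∣ → ∃[ x ] ∃[ y ] x ∈ p × y ∈ p × x ≢ y
2≤∣p∣⇒∃₂∈p {p = p} le with 1≤∣p∣⇒∃∈p (≤-trans (s≤s z≤n) le)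
... | x , x∈p with ∣p∣<∣q∣⇒∃∈q∖p (subst (_< ∣ p ∣) (sym (∣⁅x⁆∣≡1 x)) le)
...   | y , y∈p , y∉⁅x⁆ = x , y , x∈p , y∈p , λ x≡y → y∉⁅x⁆ (subst (_∈ ⁅ x ⁆) x≡y (x∈⁅x⁆ x))

∣p∣≡0⇒x∉p : ∣ p ∣ ≡ 0 → x ∉ p
∣p∣≡0⇒x∉p {x = x} ∣p∣≡0 x∈p with subst (1 ≤_) ∣p∣≡0 (subst (_≤ _) (∣⁅x⁆∣≡1 x) (p⊆q⇒∣p∣≤∣q∣ (⁅x⁆⊆ x∈p)))
... | ()

∣p∣≤1⇒x∈p⇒y∈p⇒x≡y : ∣ p ∣ ≤ 1 → x ∈ p → y ∈ p → x ≡ y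
∣p∣≤1⇒x∈p⇒y∈p⇒x≡y {x = x} {y = y} le x∈p y∈p with x ≟ y
... | yes x≡y = x≡y
... | no  x≢y = ⊥-elim (<⇒≱ (subst (_< _) (∣⁅x⁆∣≡1 x) (p⊆q∧x∈q∧x∉p⇒∣p∣<∣q∣ (⁅x⁆⊆ x∈p) y∈p y∉⁅x⁆)) le)
  where
  y∉⁅x⁆ : y ∉ ⁅ x ⁆
  y∉⁅x⁆ = x≢y ∘ sym ∘ x∈⁅y⁆⇒x≡y x

p⊆q∧∣q∣≤∣p∣⇒p≡q : p ⊆ q → ∣ q ∣ ≤ ∣ p ∣ → p ≡ q
p⊆q∧∣q∣≤∣p∣⇒p≡q {p = p} {q = q} p⊆q le = ⊆-antisym p⊆q q⊆p
  where
  q⊆p : q ⊆ p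
  q⊆p {x} x∈q with x ∈? p
  ... | yes x∈p = x∈p
  ... | no  x∉p = ⊥-elim (<⇒≱ (p⊆q∧x∈q∧x∉p⇒∣p∣<∣q∣ p⊆q x∈q x∉p) le)

∣s∩O∣<∣s∣⇒∃∈s∖O : ∣ s ∩ O ∣ < ∣ s ∣ → ∃[ x ] x ∈ s × x ∉ O
∣s∩O∣<∣s∣⇒∃∈s∖O lt with ∣p∣<∣q∣⇒∃∈q∖p lt
... | x , x∈s , x∉s∩O = x , x∈s , x∉s∩O ∘ ∈∩ x∈s

unique⇒∣p∣≤1 : (∀ {x y} → x ∈ p → y ∈ p → x ≡ y) → ∣ p ∣ ≤ 1
unique⇒∣p∣≤1 {p = p} unique with ∣ p ∣ ≤? 1
... | yes ∣p∣≤1 = ∣p∣≤1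
... | no  ∣p∣≰1 with 2≤∣p∣⇒∃₂∈p (≰⇒> ∣p∣≰1)
...   | x , y , x∈p , y∈p , x≢y = ⊥-elim (x≢y (unique x∈p y∈p))

unique-off⇒∣p∣≤2 : ∀ c → (∀ {x y} → x ∈ p → y ∈ p → x ≢ c → y ≢ c → x ≡ y) → ∣ p ∣ ≤ 2
unique-off⇒∣p∣≤2 {p = p} c unique = begin
  ∣ p ∣                              ≤⟨ p⊆q⇒∣p∣≤∣q∣ p⊆ ⟩
  ∣ ⁅ c ⁆ ∪ (p ∩ ∁ ⁅ c ⁆) ∣          ≤⟨ ∣p∪q∣≤∣p∣+∣q∣ ⁅ c ⁆ (p ∩ ∁ ⁅ c ⁆) ⟩
  ∣ ⁅ c ⁆ ∣ + ∣ p ∩ ∁ ⁅ c ⁆ ∣        ≤⟨ +-mono-≤ (≤-reflexive (∣⁅x⁆∣≡1 c)) (unique⇒∣p∣≤1 unique′) ⟩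
  2                                  ∎
  where
  open ≤-Reasoning
  p⊆ : p ⊆ ⁅ c ⁆ ∪ (p ∩ ∁ ⁅ c ⁆)
  p⊆ {x} x∈p with x ≟ c
  ... | yes refl = ∈∪ˡ (x∈⁅x⁆ c)
  ... | no  x≢c  = ∈∪ʳ (∈∩ x∈p (x∉p⇒x∈∁p (x≢c ∘ x∈⁅y⁆⇒x≡y c)))
  off : x ∈ p ∩ ∁ ⁅ c ⁆ → x ≢ c
  off x∈ refl = x∈∁p⇒x∉p (∈∩ʳ x∈) (x∈⁅x⁆ c)
  unique′ : ∀ {x y} → x ∈ p ∩ ∁ ⁅ c ⁆ → y ∈ p ∩ ∁ ⁅ c ⁆ → x ≡ y
  unique′ x∈ y∈ = unique (∈∩ˡ x∈) (∈∩ˡ y∈) (off x∈) (off y∈)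

2+∣s∩O∣≤∣s∣⇒∃₂∈s∖O : 2 + ∣ s ∩ O ∣ ≤ ∣ s ∣ → ∃[ x ] ∃[ y ] x ∈ s × y ∈ s × x ≢ y × x ∉ O × y ∉ O
2+∣s∩O∣≤∣s∣⇒∃₂∈s∖O {s = s} {O = O} le with ∣s∩O∣<∣s∣⇒∃∈s∖O {s = s} {O = O} (≤-trans (s≤s (m≤n+m _ 1)) le)
... | x , x∈s , x∉O with ∣p∣<∣q∣⇒∃∈q∖p {p = ⁅ x ⁆ ∪ (s ∩ O)}
                          (subst (_< ∣ s ∣) (sym (x∉p⇒∣⁅x⁆∪p∣≡1+∣p∣ (x∉O ∘ ∈∩ʳ))) le)
...   | y , y∈s , y∉ = x , y , x∈s , y∈s , (λ x≡y → y∉ (∈∪ˡ (subst (_∈ ⁅ x ⁆) x≡y (x∈⁅x⁆ x))))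
                     , x∉O , (λ y∈O → y∉ (∈∪ʳ (∈∩ y∈s y∈O)))

∃₂-avoiding : ∀ c → 3 ≤ ∣ s ∣ → ∃[ x ] ∃[ y ] x ∈ s × y ∈ s × x ≢ y × x ≢ c × y ≢ c
∃₂-avoiding {s = s} c 3≤∣s∣
  with 2+∣s∩O∣≤∣s∣⇒∃₂∈s∖O {O = ⁅ c ⁆}
         (≤-trans (+-monoʳ-≤ 2 (≤-trans (∣p∩q∣≤∣q∣ s ⁅ c ⁆) (≤-reflexive (∣⁅x⁆∣≡1 c)))) 3≤∣s∣)
... | x , y , x∈ , y∈ , x≢y , x∉ , y∉ = x , y , x∈ , y∈ , x≢y , x∉⁅y⁆⇒x≢y x∉ , x∉⁅y⁆⇒x≢y y∉

∃-avoiding₂ : ∀ c c′ → 3 ≤ ∣ s ∣ → ∃[ x ] x ∈ s × x ≢ c × x ≢ c′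
∃-avoiding₂ {s = s} c c′ 3≤∣s∣ with ∣s∩O∣<∣s∣⇒∃∈s∖O {O = ⁅ c ⁆ ∪ ⁅ c′ ⁆} (≤-<-trans ∣s∩O∣≤2 3≤∣s∣)
  where
  ∣s∩O∣≤2 : ∣ s ∩ (⁅ c ⁆ ∪ ⁅ c′ ⁆) ∣ ≤ 2
  ∣s∩O∣≤2 = ≤-trans (∣p∩q∣≤∣q∣ s (⁅ c ⁆ ∪ ⁅ c′ ⁆)) (≤-trans (∣p∪q∣≤∣p∣+∣q∣ ⁅ c ⁆ ⁅ c′ ⁆)
              (≤-reflexive (cong₂ _+_ (∣⁅x⁆∣≡1 c) (∣⁅x⁆∣≡1 c′))))
... | x , x∈ , x∉ = x , x∈ , x∉⁅y⁆⇒x≢y (x∉ ∘ ∈∪ˡ) , x∉⁅y⁆⇒x≢y (x∉ ∘ ∈∪ʳ)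

∈⁅⁆∪⁅⁆∪⁅⁆⁻ : x ∈ ⁅ u ⁆ ∪ (⁅ y ⁆ ∪ ⁅ z ⁆) → x ≡ u ⊎ x ≡ y ⊎ x ≡ z
∈⁅⁆∪⁅⁆∪⁅⁆⁻ {z = z} m with ∈⁅⁆∪⁻ m
... | inj₁ x≡u = inj₁ x≡u
... | inj₂ m′  = inj₂ (Sum.map₂ (x∈⁅y⁆⇒x≡y z) (∈⁅⁆∪⁻ m′))

fourthPoint : n ≡ 4 → (i j h : Fin n) → i ≢ j → i ≢ h → j ≢ h →
  ∃[ f ] f ≢ i × f ≢ j × f ≢ h × (∀ m → m ≡ i ⊎ m ≡ j ⊎ m ≡ h ⊎ m ≡ f)
fourthPoint {n} n≡4 i j h i≢j i≢h j≢h =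
  f , f≢ (∈∪ˡ (x∈⁅x⁆ i)) , f≢ (∈∪ʳ (∈∪ˡ (x∈⁅x⁆ j))) , f≢ (∈∪ʳ (∈∪ʳ (x∈⁅x⁆ h))) , covers
  where
  S : Subset n
  S = ⁅ i ⁆ ∪ (⁅ j ⁆ ∪ ⁅ h ⁆)
  ∣S∣≡3 : ∣ S ∣ ≡ 3
  ∣S∣≡3 = trans (x∉p⇒∣⁅x⁆∪p∣≡1+∣p∣ (Sum.[ i≢j , i≢h ] ∘ Sum.map₂ (x∈⁅y⁆⇒x≡y h) ∘ ∈⁅⁆∪⁻))
                (cong suc (trans (x∉p⇒∣⁅x⁆∪p∣≡1+∣p∣ (j≢h ∘ x∈⁅y⁆⇒x≡y h)) (cong suc (∣⁅x⁆∣≡1 h))))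
  ∣∁S∣≡1 : ∣ ∁ S ∣ ≡ 1
  ∣∁S∣≡1 = trans (∣∁p∣≡n∸∣p∣ S) (cong₂ _∸_ n≡4 ∣S∣≡3)
  f : Fin n
  f = proj₁ (1≤∣p∣⇒∃∈p (≤-reflexive (sym ∣∁S∣≡1)))
  f∈∁S : f ∈ ∁ S
  f∈∁S = proj₂ (1≤∣p∣⇒∃∈p (≤-reflexive (sym ∣∁S∣≡1)))
  f∉S : f ∉ S
  f∉S = x∈∁p⇒x∉p f∈∁S
  f≢ : x ∈ S → f ≢ x
  f≢ x∈S f≡x = f∉S (subst (_∈ S) (sym f≡x) x∈S)
  covers : ∀ m → m ≡ i ⊎ m ≡ j ⊎ m ≡ h ⊎ m ≡ f
  covers m with m ∈? S
  ... | yes m∈S = Sum.map₂ (Sum.map₂ inj₁) (∈⁅⁆∪⁅⁆∪⁅⁆⁻ m∈S)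
  ... | no  m∉S = inj₂ (inj₂ (inj₂ (∣p∣≤1⇒x∈p⇒y∈p⇒x≡y (≤-reflexive ∣∁S∣≡1) (x∉p⇒x∈∁p m∉S) f∈∁S)))

∈bigUnion⁺ : ∀ {m} {f : Fin m → Subset n} j → x ∈ f j → x ∈ bigUnion f
∈bigUnion⁺ zero    x∈f = ∈∪ˡ x∈f
∈bigUnion⁺ (suc j) x∈f = ∈∪ʳ (∈bigUnion⁺ j x∈f)

∈bigUnion⁻ : ∀ {m} (f : Fin m → Subset n) → x ∈ bigUnion f → ∃[ j ] x ∈ f j
∈bigUnion⁻ {m = zero}  f x∈⋃ = ⊥-elim (∉⊥ x∈⋃)
∈bigUnion⁻ {m = suc m} f x∈⋃ with x∈p∪q⁻ (f zero) _ x∈⋃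
... | inj₁ x∈f₀ = zero , x∈f₀
... | inj₂ x∈⋃′ with ∈bigUnion⁻ (f ∘ suc) x∈⋃′
...   | j , x∈fj = suc j , x∈fj

∈image⁻ : ∀ {k} (xs : Fin k → Fin n) → y ∈ image xs → ∃[ j ] xs j ≡ y
∈image⁻ xs y∈ with ∈bigUnion⁻ (λ j → ⁅ xs j ⁆) y∈
... | j , y∈⁅xj⁆ = j , sym (x∈⁅y⁆⇒x≡y _ y∈⁅xj⁆)

∣image∣≡k : ∀ {k} (xs : Fin k → Fin n) → Injective _≡_ _≡_ xs → ∣ image xs ∣ ≡ k
∣image∣≡k {n} {zero}  xs _   = ∣⊥∣≡0 n
∣image∣≡k {k = suc k} xs inj =
  trans (x∉p⇒∣⁅x⁆∪p∣≡1+∣p∣ x₀∉) (cong suc (∣image∣≡k (xs ∘ suc) (sucᶠ-injective ∘ inj)))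
  where
  x₀∉ : xs zero ∉ image (xs ∘ suc)
  x₀∉ x₀∈ with ∈image⁻ (xs ∘ suc) x₀∈
  ... | j , eq with inj eq
  ... | ()

module _ {m} (g : Fin m → Subset n) where

  ∈Earlier⁺ : ∀ {i j} → toℕ i < toℕ j → x ∈ g i → x ∈ Earlier g j
  ∈Earlier⁺ {x = x} {i} {j} i<j x∈gi = ∈bigUnion⁺ i (selected (toℕ i <ᵇ toℕ j) (<⇒<ᵇ i<j))
    where
    selected : ∀ b → T b → x ∈ (if b then g i else Subset.⊥)
    selected true _ = x∈gi

  ∈Earlier⁻ : ∀ {j} → x ∈ Earlier g j → ∃[ i ] toℕ i < toℕ j × x ∈ g i
  ∈Earlier⁻ {x = x} {j} x∈ with ∈bigUnion⁻ _ x∈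
  ... | i , x∈sel with selected (toℕ i <ᵇ toℕ j) x∈sel
    where
    selected : ∀ b → x ∈ (if b then g i else Subset.⊥) → T b × x ∈ g i
    selected true  x∈gi = _ , x∈gi
    selected false x∈⊥  = ⊥-elim (∉⊥ x∈⊥)
  ...   | i<ᵇj , x∈gi = i , <ᵇ⇒< (toℕ i) (toℕ j) i<ᵇj , x∈gi

module _ {n} (V : Fin n → Set) (E : Subset n → Set) where

  NoEdgeWithin : Subset n → Set
  NoEdgeWithin M = ∀ e → E e → ¬ e ⊆ M

  Reply : (Subset n → Subset n → Set) → Subset n → Subset n → Fin n → Set
  Reply Inv M K u =
      (∃[ w ] V w × w ∉ ⁅ u ⁆ ∪ M × w ∉ K × Inv (⁅ u ⁆ ∪ M) (⁅ w ⁆ ∪ K))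
    ⊎ (∀ w → V w → w ∉ ⁅ u ⁆ ∪ M → w ∉ K → Inv (⁅ u ⁆ ∪ M) (⁅ w ⁆ ∪ K))

  breakerWins-byInvariant : (∀ u → Dec (V u)) → (Inv : Subset n → Subset n → Set) →
    (∀ {M K} → Inv M K → ∀ u → V u → u ∉ M → u ∉ K → NoEdgeWithin (⁅ u ⁆ ∪ M) × Reply Inv M K u) →
    Inv Subset.⊥ Subset.⊥ → BreakerHasWinningStrategy V E
  breakerWins-byInvariant V? Inv step inv₀ = play (suc n) (≤-trans (n<1+n n) (m≤m+n (suc n) _)) inv₀
    where
    -- M ∪ K grows in every round, so the fuel n + 1 suffices
    play : ∀ f {M K} → n < f + ∣ M ∪ K ∣ → Inv M K → BreakerWins V E M K
    play zero    {M} {K} n<∣M∪K∣ _   = ⊥-elim (<⇒≱ n<∣M∪K∣ (∣p∣≤n (M ∪ K)))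
    play (suc f) {M} {K} n<f+∣M∪K∣ inv = breakerWins λ u u∈V u∉M u∉K →
      proj₁ (step inv u u∈V u∉M u∉K) , answer u u∉M u∉K (proj₂ (step inv u u∈V u∉M u∉K))
      where
      grows : ∀ {u w} → u ∉ M → u ∉ K → n < f + ∣ (⁅ u ⁆ ∪ M) ∪ (⁅ w ⁆ ∪ K) ∣
      grows {u} {w} u∉M u∉K = ≤-trans n<f+∣M∪K∣ (≤-trans (≤-reflexive (sym (+-suc f _)))
        (+-monoʳ-≤ f (p⊆q∧x∈q∧x∉p⇒∣p∣<∣q∣ M∪K⊆ (∈∪ˡ (∈∪ˡ (x∈⁅x⁆ u))) (Sum.[ u∉M , u∉K ] ∘ x∈p∪q⁻ M K))))
        where
        M∪K⊆ : M ∪ K ⊆ (⁅ u ⁆ ∪ M) ∪ (⁅ w ⁆ ∪ K)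
        M∪K⊆ m = Sum.[ ∈∪ˡ ∘ ∈∪ʳ , ∈∪ʳ ∘ ∈∪ʳ ] (x∈p∪q⁻ M K m)
      answer : ∀ u → u ∉ M → u ∉ K → Reply Inv M K u →
        (∀ w → V w → w ∈ ⁅ u ⁆ ∪ M ⊎ w ∈ K)
        ⊎ ∃[ w ] V w × w ∉ ⁅ u ⁆ ∪ M × w ∉ K × BreakerWins V E (⁅ u ⁆ ∪ M) (⁅ w ⁆ ∪ K)
      answer u u∉M u∉K (inj₁ (w , w∈V , w∉M , w∉K , inv′)) =
        inj₂ (w , w∈V , w∉M , w∉K , play f (grows u∉M u∉K) inv′)
      answer u u∉M u∉K (inj₂ anyMove)
        with any? (λ w → V? w ×-dec ¬? (w ∈? ⁅ u ⁆ ∪ M) ×-dec ¬? (w ∈? K))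
      ... | yes (w , w∈V , w∉M , w∉K) =
        inj₂ (w , w∈V , w∉M , w∉K , play f (grows u∉M u∉K) (anyMove w w∈V w∉M w∉K))
      ... | no noFreeVertex = inj₁ claimed
        where
        claimed : ∀ w → V w → w ∈ ⁅ u ⁆ ∪ M ⊎ w ∈ K
        claimed w w∈V with w ∈? ⁅ u ⁆ ∪ M | w ∈? K
        ... | yes w∈M | _       = inj₁ w∈M
        ... | no  _   | yes w∈K = inj₂ w∈K
        ... | no  w∉M | no  w∉K = ⊥-elim (noFreeVertex (w , w∈V , w∉M , w∉K))

record PairFamily (n : ℕ) : Set where
  field
    size    : ℕ
    active  : Fin size → Bool
    fst snd : Fin size → Fin n
    fst≢snd : ∀ {j} → T (active j) → fst j ≢ snd j
    apart   : ∀ {j j′ x} → T (active j) → T (active j′) → j ≢ j′ →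
              x ≡ fst j ⊎ x ≡ snd j → ¬ (x ≡ fst j′ ⊎ x ≡ snd j′)

  Active : Fin size → Set
  Active j = T (active j)

  infix 4 _~_
  _~_ : Fin n → Fin n → Set
  x ~ y = ∃[ j ] Active j × (fst j ≡ x × snd j ≡ y ⊎ snd j ≡ x × fst j ≡ y)

  ~-sym : x ~ y → y ~ x
  ~-sym (j , act , inj₁ (refl , refl)) = j , act , inj₂ (refl , refl)
  ~-sym (j , act , inj₂ (refl , refl)) = j , act , inj₁ (refl , refl)

  ~-irrefl : x ~ y → x ≢ y
  ~-irrefl (j , act , inj₁ (refl , refl)) = fst≢snd act
  ~-irrefl (j , act , inj₂ (refl , refl)) = fst≢snd act ∘ sym

  ~-functional : x ~ y → x ~ z → y ≡ z
  ~-functional (j , act , p) (j′ , act′ , p′) with j ≟ j′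
  ~-functional (j , act , inj₁ (refl , refl)) (j , _ , inj₁ (refl , refl)) | yes refl = refl
  ~-functional (j , act , inj₁ (refl , refl)) (j , _ , inj₂ (x≡ , refl)) | yes refl =
    ⊥-elim (fst≢snd act (sym x≡))
  ~-functional (j , act , inj₂ (refl , refl)) (j , _ , inj₁ (x≡ , refl)) | yes refl =
    ⊥-elim (fst≢snd act x≡)
  ~-functional (j , act , inj₂ (refl , refl)) (j , _ , inj₂ (refl , refl)) | yes refl = refl
  ... | no j≢j′ = ⊥-elim (apart act act′ j≢j′ (endpoint p) (endpoint p′))
    where
    endpoint : ∀ {i} → fst i ≡ x × snd i ≡ y ⊎ snd i ≡ x × fst i ≡ y → x ≡ fst i ⊎ x ≡ snd i
    endpoint (inj₁ (refl , _)) = inj₁ refl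
    endpoint (inj₂ (refl , _)) = inj₂ refl

  ~-elim : {R : Fin n → Fin n → Set} → (∀ {x y} → R x y → R y x) →
           (∀ {j} → Active j → R (fst j) (snd j)) → x ~ y → R x y
  ~-elim R-sym R-pairs (j , act , inj₁ (refl , refl)) = R-pairs act
  ~-elim R-sym R-pairs (j , act , inj₂ (refl , refl)) = R-sym (R-pairs act)

  partner? : ∀ x → Dec (∃[ y ] x ~ y)
  partner? x with any? (λ j → T? (active j) ×-dec ((fst j ≟ x) ⊎-dec (snd j ≟ x)))
  ... | yes (j , act , inj₁ refl) = yes (snd j , j , act , inj₁ (refl , refl))
  ... | yes (j , act , inj₂ refl) = yes (fst j , j , act , inj₂ (refl , refl))
  ... | no none = no λ { (_ , j , act , inj₁ (x≡ , _)) → none (j , act , inj₁ x≡)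
                       ; (_ , j , act , inj₂ (x≡ , _)) → none (j , act , inj₂ x≡) }

open PairFamily using (~-sym; ~-irrefl; ~-functional; ~-elim; partner?)

pairFamily : ∀ q (fst snd : Fin q → Fin n) → (∀ j → fst j ≢ snd j) →
  (∀ {j j′ x} → j ≢ j′ → x ≡ fst j ⊎ x ≡ snd j → ¬ (x ≡ fst j′ ⊎ x ≡ snd j′)) → PairFamily n
pairFamily q fst snd fst≢snd apart = record
  { size = q ; active = λ _ → true ; fst = fst ; snd = snd
  ; fst≢snd = λ {j} _ → fst≢snd j ; apart = λ _ _ → apart }

twoPairs : (x₀ y₀ x₁ y₁ : Fin n) → x₀ ≢ y₀ → x₁ ≢ y₁ →
  (∀ {x} → x ≡ x₀ ⊎ x ≡ y₀ → ¬ (x ≡ x₁ ⊎ x ≡ y₁)) → PairFamily n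
twoPairs {n} x₀ y₀ x₁ y₁ x₀≢y₀ x₁≢y₁ apart =
  pairFamily 2 fst snd (λ { zero → x₀≢y₀ ; (suc zero) → x₁≢y₁ })
    λ { {zero} {zero} 0≢0 → ⊥-elim (0≢0 refl)
      ; {zero} {suc zero} _ → apart
      ; {suc zero} {zero} _ → λ x∈₁ x∈₀ → apart x∈₀ x∈₁
      ; {suc zero} {suc zero} 1≢1 → ⊥-elim (1≢1 refl) }
  where
  fst snd : Fin 2 → Fin n
  fst zero       = x₀
  fst (suc zero) = x₁
  snd zero       = y₀
  snd (suc zero) = y₁

apart-byOrder : ∀ {m} {Active : Fin m → Set} {Mem : Fin m → Fin n → Set} →
  (∀ {i j x} → toℕ i < toℕ j → Active i → Active j → Mem i x → ¬ Mem j x) →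
  ∀ {i j x} → Active i → Active j → i ≢ j → Mem i x → ¬ Mem j x
apart-byOrder later-avoids {i} {j} act act′ i≢j x∈i x∈j with <-cmp (toℕ i) (toℕ j)
... | tri< i<j _ _ = later-avoids i<j act act′ x∈i x∈j
... | tri≈ _ i≡j _ = i≢j (toℕ-injective i≡j)
... | tri> _ _ j<i = later-avoids j<i act′ act x∈j x∈i

infix 4 _~[_]_
_~[_]_ : Fin n → PairFamily n → Fin n → Set
x ~[ π ] y = PairFamily._~_ π x y

ContainsPair : PairFamily n → Subset n → Set
ContainsPair π f = ∃[ x ] ∃[ y ] x ~[ π ] y × x ∈ f × y ∈ f

Disjoint : Subset n → Subset n → Set
Disjoint M K = ∀ {x} → x ∈ M → x ∉ K

disjoint-step : Disjoint M K → u ∉ K → w ∉ ⁅ u ⁆ ∪ M → Disjoint (⁅ u ⁆ ∪ M) (⁅ w ⁆ ∪ K)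
disjoint-step {M = M} {K = K} {u = u} {w = w} M∩K≡∅ u∉K w∉ {x} x∈ x∈′ with ∈⁅⁆∪⁻ x∈ | ∈⁅⁆∪⁻ x∈′
... | _          | inj₁ refl = w∉ x∈
... | inj₁ refl  | inj₂ x∈K  = u∉K x∈K
... | inj₂ x∈M   | inj₂ x∈K  = M∩K≡∅ x∈M x∈K

Answered : PairFamily n → Subset n → Subset n → Set
Answered π M K = ∀ {x y} → x ~[ π ] y → x ∈ M → y ∈ K

module _ (π : PairFamily n) where

  answered-⊆ : Answered π M K → K ⊆ K′ → Answered π M K′
  answered-⊆ ans K⊆K′ x~y x∈M = K⊆K′ (ans x~y x∈M)

  answered-partner : Answered π M K → K ⊆ K′ → u ~[ π ] y → y ∈ K′ → Answered π (⁅ u ⁆ ∪ M) K′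
  answered-partner ans K⊆K′ u~y y∈K′ x~z x∈ with ∈⁅⁆∪⁻ x∈
  ... | inj₁ refl rewrite ~-functional π x~z u~y = y∈K′
  ... | inj₂ x∈M  = K⊆K′ (ans x~z x∈M)

  answered-unpaired : Answered π M K → K ⊆ K′ → ¬ (∃[ y ] u ~[ π ] y) → Answered π (⁅ u ⁆ ∪ M) K′
  answered-unpaired ans K⊆K′ unpaired x~z x∈ with ∈⁅⁆∪⁻ x∈
  ... | inj₁ refl = ⊥-elim (unpaired (_ , x~z))
  ... | inj₂ x∈M  = K⊆K′ (ans x~z x∈M)

  pair-not-claimed : Disjoint M K → Answered π M K → u ∉ K → x ~[ π ] y →
                     x ∈ ⁅ u ⁆ ∪ M → y ∉ ⁅ u ⁆ ∪ M
  pair-not-claimed M∩K≡∅ ans u∉K x~y x∈ y∈ with ∈⁅⁆∪⁻ x∈ | ∈⁅⁆∪⁻ y∈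
  ... | inj₁ refl | inj₁ refl = ~-irrefl π x~y refl
  ... | inj₁ refl | inj₂ y∈M  = u∉K (ans (~-sym π x~y) y∈M)
  ... | inj₂ x∈M  | inj₁ refl = u∉K (ans x~y x∈M)
  ... | inj₂ x∈M  | inj₂ y∈M  = M∩K≡∅ y∈M (ans x~y x∈M)

  partner-unclaimed : Disjoint M K → Answered π M K → u ∉ K → u ~[ π ] y → y ∉ ⁅ u ⁆ ∪ M
  partner-unclaimed M∩K≡∅ ans u∉K u~y = pair-not-claimed M∩K≡∅ ans u∉K u~y (∈∪ˡ (x∈⁅x⁆ _))

module Strategies {n} (V P : Fin n → Set) (CoreEdge : Subset n → Set) where

  record CoreStrategy : Set₁ where
    field
      Inv                : Subset n → Subset n → Set
      initial            : Inv Subset.⊥ Subset.⊥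
      breakerClaims      : Inv M K → Inv M (⁅ w ⁆ ∪ K)
      makerClaimsOutside : ¬ P u → Inv M K → Inv (⁅ u ⁆ ∪ M) K
      coreEdgeBlocked    : ∀ {f} → CoreEdge f → Disjoint M K → Inv M K → u ∉ K → ¬ f ⊆ ⁅ u ⁆ ∪ M
      makerClaimsInside  : Disjoint M K → Inv M K → P u → V u → u ∉ M → u ∉ K →
        (∃[ w ] V w × w ∉ ⁅ u ⁆ ∪ M × w ∉ K × Inv (⁅ u ⁆ ∪ M) (⁅ w ⁆ ∪ K)) ⊎ Inv (⁅ u ⁆ ∪ M) K

  module _ {E : Subset n → Set} (V? : ∀ u → Dec (V u)) (P? : ∀ u → Dec (P u)) (τ : PairFamily n)
    (τ-pairs : ∀ {x y} → x ~[ τ ] y → V y × ¬ P x)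
    (edges : ∀ f → E f → ContainsPair τ f ⊎ CoreEdge f)
    (core : CoreStrategy) where

    open CoreStrategy core

    Position : Subset n → Subset n → Set
    Position M K = Disjoint M K × Answered τ M K × Inv M K

    move : Position M K → ∀ u → V u → u ∉ M → u ∉ K →
           NoEdgeWithin V E (⁅ u ⁆ ∪ M) × Reply V E Position M K u
    move {M} {K} (M∩K≡∅ , ans , inv) u u∈V u∉M u∉K = noEdge , reply
      where
      noEdge : NoEdgeWithin V E (⁅ u ⁆ ∪ M)
      noEdge f f∈E f⊆ with edges f f∈E
      ... | inj₁ (x , y , x~y , x∈f , y∈f) = pair-not-claimed τ M∩K≡∅ ans u∉K x~y (f⊆ x∈f) (f⊆ y∈f)
      ... | inj₂ f-core = coreEdgeBlocked f-core M∩K≡∅ inv u∉K f⊆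
      anyMove : Inv (⁅ u ⁆ ∪ M) K → (∀ {w} → Answered τ (⁅ u ⁆ ∪ M) (⁅ w ⁆ ∪ K)) →
                ∀ w → V w → w ∉ ⁅ u ⁆ ∪ M → w ∉ K → Position (⁅ u ⁆ ∪ M) (⁅ w ⁆ ∪ K)
      anyMove inv′ ans′ w _ w∉ _ = disjoint-step M∩K≡∅ u∉K w∉ , ans′ , breakerClaims inv′
      reply : Reply V E Position M K u
      reply with partner? τ u
      ... | yes (y , u~y) with y ∈? K
      ...   | yes y∈K = inj₂ (anyMove (makerClaimsOutside (proj₂ (τ-pairs u~y)) inv)
                                      (answered-partner τ ans ∈∪ʳ u~y (∈∪ʳ y∈K)))
      ...   | no  y∉K = inj₁ (y , proj₁ (τ-pairs u~y) , y∉ , y∉K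
                             , disjoint-step M∩K≡∅ u∉K y∉
                             , answered-partner τ ans ∈∪ʳ u~y (∈∪ˡ (x∈⁅x⁆ y))
                             , breakerClaims (makerClaimsOutside (proj₂ (τ-pairs u~y)) inv))
        where
        y∉ : y ∉ ⁅ u ⁆ ∪ M
        y∉ = partner-unclaimed τ M∩K≡∅ ans u∉K u~y
      reply | no unpaired with P? u
      ... | no  u∉P = inj₂ (anyMove (makerClaimsOutside u∉P inv) (answered-unpaired τ ans ∈∪ʳ unpaired))
      ... | yes u∈P with makerClaimsInside M∩K≡∅ inv u∈P u∈V u∉M u∉K
      ...   | inj₁ (w , w∈V , w∉ , w∉K , inv′) =
                inj₁ (w , w∈V , w∉ , w∉K , disjoint-step M∩K≡∅ u∉K w∉
                     , answered-unpaired τ ans ∈∪ʳ unpaired , inv′)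
      ...   | inj₂ inv′ = inj₂ (anyMove inv′ (answered-unpaired τ ans ∈∪ʳ unpaired))

    breakerWins-pairing+core : BreakerHasWinningStrategy V E
    breakerWins-pairing+core = breakerWins-byInvariant V E V? Position move
      ((λ x∈⊥ → ⊥-elim (∉⊥ x∈⊥)) , (λ _ x∈⊥ → ⊥-elim (∉⊥ x∈⊥)) , initial)

  module _ (σ : PairFamily n) (σ-pairs : ∀ {x y} → x ~[ σ ] y → P x × V y) where

    Covered : Subset n → Subset n → Set
    Covered K f = (∃[ z ] z ∈ f × z ∈ K) ⊎ ContainsPair σ f

    PairingInv : Subset n → Subset n → Set
    PairingInv M K = Answered σ M K × (∀ {f} → CoreEdge f → Covered K f)

    pairingInv-breakerClaims : PairingInv M K → PairingInv M (⁅ w ⁆ ∪ K)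
    pairingInv-breakerClaims (ans , covered) =
      answered-⊆ σ ans ∈∪ʳ , Sum.map₁ (λ (z , z∈f , z∈K) → z , z∈f , ∈∪ʳ z∈K) ∘ covered

    pairingInv-makerClaimsOutside : ¬ P u → PairingInv M K → PairingInv (⁅ u ⁆ ∪ M) K
    pairingInv-makerClaimsOutside u∉P (ans , covered) =
      answered-unpaired σ ans (λ z∈K → z∈K) (u∉P ∘ proj₁ ∘ σ-pairs ∘ proj₂) , covered

    pairingInv-coreEdgeBlocked : ∀ {f} → CoreEdge f → Disjoint M K → PairingInv M K → u ∉ K →
                                 ¬ f ⊆ ⁅ u ⁆ ∪ M
    pairingInv-coreEdgeBlocked f-core M∩K≡∅ (ans , covered) u∉K f⊆ with covered f-core
    ... | inj₂ (x , y , x~y , x∈f , y∈f) = pair-not-claimed σ M∩K≡∅ ans u∉K x~y (f⊆ x∈f) (f⊆ y∈f)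
    ... | inj₁ (z , z∈f , z∈K) with ∈⁅⁆∪⁻ (f⊆ z∈f)
    ...   | inj₁ refl = u∉K z∈K
    ...   | inj₂ z∈M  = M∩K≡∅ z∈M z∈K

    pairingInv-makerClaims : Disjoint M K → PairingInv M K → u ∉ K →
      (∃[ w ] V w × w ∉ ⁅ u ⁆ ∪ M × w ∉ K × PairingInv (⁅ u ⁆ ∪ M) (⁅ w ⁆ ∪ K)) ⊎ PairingInv (⁅ u ⁆ ∪ M) K
    pairingInv-makerClaims {K = K} {u = u} M∩K≡∅ inv@(ans , covered) u∉K with partner? σ u
    ... | no unpaired = inj₂ (answered-unpaired σ ans (λ z∈K → z∈K) unpaired , covered)
    ... | yes (y , u~y) with y ∈? K
    ...   | yes y∈K = inj₂ (answered-partner σ ans (λ z∈K → z∈K) u~y y∈K , covered)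
    ...   | no  y∉K = inj₁ (y , proj₂ (σ-pairs u~y) , partner-unclaimed σ M∩K≡∅ ans u∉K u~y , y∉K
                           , answered-partner σ ans ∈∪ʳ u~y (∈∪ˡ (x∈⁅x⁆ y))
                           , proj₂ (pairingInv-breakerClaims inv))

  pairingCore : (σ : PairFamily n) (σ-pairs : ∀ {x y} → x ~[ σ ] y → P x × V y) →
                (∀ {f} → CoreEdge f → ContainsPair σ f) → CoreStrategy
  pairingCore σ σ-pairs coreEdgesPaired = record
    { Inv                = PairingInv σ σ-pairs
    ; initial            = (λ _ x∈⊥ → ⊥-elim (∉⊥ x∈⊥)) , inj₂ ∘ coreEdgesPaired
    ; breakerClaims      = pairingInv-breakerClaims σ σ-pairs
    ; makerClaimsOutside = pairingInv-makerClaimsOutside σ σ-pairs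
    ; coreEdgeBlocked    = pairingInv-coreEdgeBlocked σ σ-pairs
    ; makerClaimsInside  = λ M∩K≡∅ inv _ _ _ u∉K → pairingInv-makerClaims σ σ-pairs M∩K≡∅ inv u∉K
    }

open Strategies

record CorePairing {n m} (g : Fin m → Subset n) : Set₁ where
  field
    pairing     : PairFamily n
    pairInEdge  : ∀ {x y} → x ~[ pairing ] y → ∃[ j ] x ∈ g j × y ∈ g j
    edgeHasPair : ∀ j → ContainsPair pairing (g j)

InCore : ∀ {m} → (Fin m → Subset n) → Fin n → Set
InCore g x = ∃[ j ] x ∈ g j

CoreEdge : ∀ {m} → (Fin m → Subset n) → Subset n → Set
CoreEdge g f = ∃[ j ] g j ≡ f

corePairing⇒CoreStrategy : ∀ {m} {g : Fin m → Subset n} (V : Fin n → Set) → (∀ {j x} → x ∈ g j → V x) →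
  CorePairing g → CoreStrategy V (InCore g) (CoreEdge g)
corePairing⇒CoreStrategy {g = g} V core⊆V cp = pairingCore V _ _ pairing σ-pairs covers
  where
  open CorePairing cp
  σ-pairs : x ~[ pairing ] y → InCore g x × V y
  σ-pairs x~y with pairInEdge x~y
  ... | j , x∈ , y∈ = (j , x∈) , core⊆V y∈
  covers : ∀ {f} → CoreEdge g f → ContainsPair pairing f
  covers (j , refl) = edgeHasPair j

corePairing : ∀ {m} {g : Fin m → Subset n} (π : PairFamily n) → let open PairFamily π in
  (∀ {j} → Active j → ∃[ c ] fst j ∈ g c × snd j ∈ g c) →
  (∀ c → ∃[ j ] Active j × fst j ∈ g c × snd j ∈ g c) → CorePairing g
corePairing π pairs-inside edges-paired = record
  { pairing     = π
  ; pairInEdge  = ~-elim π (λ (c , x∈ , y∈) → c , y∈ , x∈) pairs-inside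
  ; edgeHasPair = λ c → let (j , act , x∈ , y∈) = edges-paired c
                        in _ , _ , (j , act , inj₁ (refl , refl)) , x∈ , y∈
  }

singlePair : ∀ {m} {g : Fin (suc m) → Subset n} → x ≢ y → (∀ j → x ∈ g j × y ∈ g j) → CorePairing g
singlePair {n} {x = x} {y = y} x≢y x,y∈g = corePairing π (λ _ → zero , x,y∈g zero) (λ c → zero , tt , x,y∈g c)
  where
  π : PairFamily n
  π = pairFamily 1 (λ _ → x) (λ _ → y) (λ _ → x≢y) λ { {zero} {zero} 0≢0 → ⊥-elim (0≢0 refl) }

oneEdge⇒CorePairing : ∀ {a} {g : Fin (suc a) → Subset n} → a ≡ 0 → 2 ≤ ∣ g zero ∣ → CorePairing g
oneEdge⇒CorePairing refl 2≤∣g₀∣ with 2≤∣p∣⇒∃₂∈p 2≤∣g₀∣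
... | x , y , x∈ , y∈ , x≢y = singlePair x≢y λ { zero → x∈ , y∈ }

overlappingPair⇒CorePairing : ∀ {k u} {g : Fin u → Subset n} → OverlappingPair k g → CorePairing g
overlappingPair⇒CorePairing {g = g} (_ , _ , refl , intersections)
  with 2≤∣p∣⇒∃₂∈p (proj₁ (intersections zero (suc zero) (s≤s z≤n)))
... | x , y , x∈ , y∈ , x≢y = singlePair x≢y λ { zero → ∈∩ˡ x∈ , ∈∩ˡ y∈ ; (suc zero) → ∈∩ʳ x∈ , ∈∩ʳ y∈ }

doubleStar⇒CorePairing : ∀ {k m u} {g : Fin u → Subset n} → (∀ j → 3 ≤ ∣ g j ∣) →
                         DoubleStar k m g → CorePairing g
doubleStar⇒CorePairing {n} {m = m} {g = g} 3≤∣g∣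
  (_ , _ , s₁ , s₂ , _ , _ , _ , cover , c₁ , _ , _ , (_ , star₁) , _ , same) =
  corePairing π (λ {i} _ → s₁ i , fst∈ i , snd∈ i) edges-paired
  where
  offCentre : ∀ i → ∃[ x ] ∃[ y ] x ∈ g (s₁ i) × y ∈ g (s₁ i) × x ≢ y × x ≢ c₁ × y ≢ c₁
  offCentre i = ∃₂-avoiding c₁ (3≤∣g∣ (s₁ i))
  fst snd : Fin m → Fin n
  fst i = proj₁ (offCentre i)
  snd i = proj₁ (proj₂ (offCentre i))
  fst∈ : ∀ i → fst i ∈ g (s₁ i)
  fst∈ i = proj₁ (proj₂ (proj₂ (offCentre i)))
  snd∈ : ∀ i → snd i ∈ g (s₁ i)
  snd∈ i = proj₁ (proj₂ (proj₂ (proj₂ (offCentre i))))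
  member : ∀ {i} → x ≡ fst i ⊎ x ≡ snd i → x ∈ g (s₁ i) × x ≢ c₁
  member {i = i} (inj₁ refl) = fst∈ i , proj₁ (proj₂ (proj₂ (proj₂ (proj₂ (proj₂ (offCentre i))))))
  member {i = i} (inj₂ refl) = snd∈ i , proj₂ (proj₂ (proj₂ (proj₂ (proj₂ (proj₂ (offCentre i))))))
  π : PairFamily n
  π = pairFamily m fst snd (proj₁ ∘ proj₂ ∘ proj₂ ∘ proj₂ ∘ proj₂ ∘ offCentre)
    λ {i} {i′} i≢i′ x∈i x∈i′ → proj₂ (member x∈i) (x∈⁅y⁆⇒x≡y c₁
      (subst (_ ∈_) (star₁ i i′ i≢i′) (∈∩ (proj₁ (member x∈i)) (proj₁ (member x∈i′)))))
  toS₂ : ∀ {i} → x ∈ g (s₁ i) → x ≢ c₁ → x ∈ g (s₂ i)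
  toS₂ {i = i} x∈ x≢c₁ = ∈∩ˡ (subst (_ ∈_) (same i) (∈∩ x∈ (x∉p⇒x∈∁p (x≢y⇒x∉⁅y⁆ x≢c₁))))
  edges-paired : ∀ c → ∃[ i ] ⊤ × fst i ∈ g c × snd i ∈ g c
  edges-paired c with cover c
  ... | inj₁ (i , refl) = i , tt , fst∈ i , snd∈ i
  ... | inj₂ (i , refl) =
    i , tt , toS₂ (fst∈ i) (proj₂ (member (inj₁ refl))) , toS₂ (snd∈ i) (proj₂ (member (inj₂ refl)))

d≤⌊k/a⌋⇒d+2≤k : ∀ {k d a} → 3 ≤ k → 2 ≤ a → d ≤ floorDiv k a → d + 2 ≤ k
d≤⌊k/a⌋⇒d+2≤k {k} {d} {suc a} 3≤k 2≤a d≤⌊k/a⌋ = bound d (≤-trans (*-monoʳ-≤ d 2≤a) d*a≤k)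
  where
  d*a≤k : d * suc a ≤ k
  d*a≤k = ≤-trans (*-monoˡ-≤ (suc a) d≤⌊k/a⌋) (m/n*n≤m k (suc a))
  bound : ∀ d → d * 2 ≤ k → d + 2 ≤ k
  bound zero                _     = ≤-trans (s≤s (s≤s z≤n)) 3≤k
  bound (suc zero)          _     = 3≤k
  bound d@(suc (suc d′)) 2d≤k = ≤-trans (≤-trans (+-monoʳ-≤ d (s≤s (s≤s z≤n)))
                                  (≤-reflexive (trans (cong (d +_) (sym (+-identityʳ d))) (*-comm 2 d))))
                              2d≤k

module LinkCore {k d a} {g : Fin (3 + a) → Subset n} (d+2≤k : d + 2 ≤ k) (∣g∣≡k : ∀ j → ∣ g j ∣ ≡ k)
  (g-inj : Injective _≡_ _≡_ g) (∣U∣≡k+d : ∣ bigUnion g ∣ ≡ k + d)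
  (union : ∀ i j → i ≢ j → g i ∪ g j ≡ bigUnion g) where

  U : Subset n
  U = bigUnion g
  g⊆U : ∀ j → g j ⊆ U
  g⊆U j = ∈bigUnion⁺ {f = g} j
  1≤d : 1 ≤ d
  1≤d = n≢0⇒n>0 λ d≡0 → case g-inj (trans (whole d≡0 zero) (sym (whole d≡0 (suc zero)))) of λ ()
    where
    whole : d ≡ 0 → ∀ j → g j ≡ U
    whole d≡0 j = p⊆q∧∣q∣≤∣p∣⇒p≡q (g⊆U j)
      (≤-reflexive (trans ∣U∣≡k+d (trans (cong (k +_) d≡0) (trans (+-identityʳ k) (sym (∣g∣≡k j))))))
  missing : ∀ j → ∃[ x ] x ∈ U × x ∉ g j
  missing j = ∣p∣<∣q∣⇒∃∈q∖p (subst₂ _<_ (sym (∣g∣≡k j)) (sym ∣U∣≡k+d)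
                 (≤-trans (≤-reflexive (trans (cong suc (sym (+-identityʳ k))) (sym (+-suc k 0))))
                          (+-monoʳ-≤ k 1≤d)))
  miss : Fin (3 + a) → Fin n
  miss j = proj₁ (missing j)
  miss∉ : ∀ j → miss j ∉ g j
  miss∉ j = proj₂ (proj₂ (missing j))
  miss∈ : ∀ {i j} → i ≢ j → miss i ∈ g j
  miss∈ {i} {j} i≢j = Sum.[ ⊥-elim ∘ miss∉ i , (λ x∈gj → x∈gj) ]
    (x∈p∪q⁻ (g i) (g j) (subst (miss i ∈_) (sym (union i j i≢j)) (proj₁ (proj₂ (missing i)))))
  2≤∣g₀∩g₁∣ : 2 ≤ ∣ g zero ∩ g (suc zero) ∣
  2≤∣g₀∩g₁∣ = +-cancelˡ-≤ d 2 ∣ g zero ∩ g (suc zero) ∣ (≤-trans d+2≤k (≤-reflexive (sym d+∣g₀∩g₁∣≡k)))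
    where
    d+∣g₀∩g₁∣≡k : d + ∣ g zero ∩ g (suc zero) ∣ ≡ k
    d+∣g₀∩g₁∣≡k = +-cancelˡ-≡ k _ _ (begin
      k + (d + ∣ g₀∩g₁ ∣)                   ≡⟨ sym (+-assoc k d _) ⟩
      k + d + ∣ g₀∩g₁ ∣                     ≡⟨ cong (_+ ∣ g₀∩g₁ ∣) (sym (trans (cong ∣_∣ g₀∪g₁≡U) ∣U∣≡k+d)) ⟩
      ∣ g zero ∪ g (suc zero) ∣ + ∣ g₀∩g₁ ∣ ≡⟨ ∣p∪q∣+∣p∩q∣≡∣p∣+∣q∣ (g zero) (g (suc zero)) ⟩
      ∣ g zero ∣ + ∣ g (suc zero) ∣         ≡⟨ cong₂ _+_ (∣g∣≡k zero) (∣g∣≡k (suc zero)) ⟩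
      k + k                                 ∎)
      where
      open ≡-Reasoning
      g₀∩g₁ : Subset n
      g₀∩g₁ = g zero ∩ g (suc zero)
      g₀∪g₁≡U : g zero ∪ g (suc zero) ≡ U
      g₀∪g₁≡U = union zero (suc zero) (λ ())
  r-spec : ∃[ r ] r ∈ g zero ∩ g (suc zero) × r ∉ ⁅ miss (suc (suc zero)) ⁆
  r-spec = ∣s∩O∣<∣s∣⇒∃∈s∖O (≤-trans (s≤s (≤-trans (∣p∩q∣≤∣q∣ (g zero ∩ g (suc zero)) ⁅ m₂ ⁆)
                                                  (≤-reflexive (∣⁅x⁆∣≡1 m₂)))) 2≤∣g₀∩g₁∣)
    where
    m₂ : Fin n
    m₂ = miss (suc (suc zero))
  r : Fin n
  r = proj₁ r-spec
  r∈g₀ : r ∈ g zero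
  r∈g₀ = ∈∩ˡ (proj₁ (proj₂ r-spec))
  r∈g₁ : r ∈ g (suc zero)
  r∈g₁ = ∈∩ʳ (proj₁ (proj₂ r-spec))
  ∈∉⇒≢ : ∀ {p} → x ∈ p → y ∉ p → x ≢ y
  ∈∉⇒≢ x∈ y∉ refl = y∉ x∈
  first-apart : x ≡ miss zero ⊎ x ≡ miss (suc zero) → ¬ (x ≡ miss (suc (suc zero)) ⊎ x ≡ r)
  first-apart (inj₁ refl) (inj₁ eq) = ∈∉⇒≢ (miss∈ λ ()) (miss∉ (suc (suc zero))) eq
  first-apart (inj₁ refl) (inj₂ eq) = ∈∉⇒≢ r∈g₀ (miss∉ zero) (sym eq)
  first-apart (inj₂ refl) (inj₁ eq) = ∈∉⇒≢ (miss∈ λ ()) (miss∉ (suc (suc zero))) eq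
  first-apart (inj₂ refl) (inj₂ eq) = ∈∉⇒≢ r∈g₁ (miss∉ (suc zero)) (sym eq)
  π : PairFamily n
  π = twoPairs (miss zero) (miss (suc zero)) (miss (suc (suc zero))) r
    (∈∉⇒≢ (miss∈ λ ()) (miss∉ (suc zero)))
    (λ m₂≡r → proj₂ (proj₂ r-spec) (subst (_∈ ⁅ miss (suc (suc zero)) ⁆) m₂≡r (x∈⁅x⁆ _)))
    first-apart
  open PairFamily π using (fst; snd)
  pairs-inside : ∀ {j} → ⊤ → ∃[ c ] fst j ∈ g c × snd j ∈ g c
  pairs-inside {zero}     _ = suc (suc zero) , miss∈ (λ ()) , miss∈ (λ ())
  pairs-inside {suc zero} _ = zero , miss∈ (λ ()) , r∈g₀
  edges-paired : ∀ c → ∃[ j ] ⊤ × fst j ∈ g c × snd j ∈ g c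
  edges-paired zero             = suc zero , tt , miss∈ (λ ()) , r∈g₀
  edges-paired (suc zero)       = suc zero , tt , miss∈ (λ ()) , r∈g₁
  edges-paired c@(suc (suc _)) = zero , tt , miss∈ (λ ()) , miss∈ (λ ())

  linkPairing : CorePairing g
  linkPairing = corePairing π (λ {j} → pairs-inside {j}) edges-paired

link⇒CorePairing : ∀ {k d a} {g : Fin (suc a) → Subset n} → 3 ≤ k → 2 ≤ a → d ≤ floorDiv k a →
  (∀ j → ∣ g j ∣ ≡ k) → Injective _≡_ _≡_ g → Link k d g → CorePairing g
link⇒CorePairing 3≤k 2≤a@(s≤s (s≤s _)) d≤⌊k/a⌋ ∣g∣≡k g-inj (_ , ∣U∣≡k+d , union) =
  LinkCore.linkPairing (d≤⌊k/a⌋⇒d+2≤k 3≤k 2≤a d≤⌊k/a⌋) ∣g∣≡k g-inj ∣U∣≡k+d union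

CycleAdjacent : ∀ {a} → Fin (suc a) → Fin (suc a) → Set
CycleAdjacent {a} i j = toℕ j ≡ suc (toℕ i) ⊎ (toℕ i ≡ 0 × suc (toℕ j) ≡ suc a)

module LooseCycleCore {a} {g : Fin (suc a) → Subset n} (3≤∣g∣ : ∀ j → 3 ≤ ∣ g j ∣) (2≤a : 2 ≤ a)
  (meetings : ∀ i j → toℕ i < toℕ j →
     (CycleAdjacent i j → ∣ g i ∩ g j ∣ ≡ 1) × (¬ CycleAdjacent i j → ∣ g i ∩ g j ∣ ≡ 0)) where

  meet⇒adjacent : ∀ {i j} → toℕ i < toℕ j → x ∈ g i → x ∈ g j → CycleAdjacent i j
  meet⇒adjacent {i = i} {j} i<j x∈gi x∈gj
    with (toℕ j ≟ℕ suc (toℕ i)) ⊎-dec ((toℕ i ≟ℕ 0) ×-dec (suc (toℕ j) ≟ℕ suc a))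
  ... | yes adjacent = adjacent
  ... | no  ¬adjacent = ⊥-elim (∣p∣≡0⇒x∉p (proj₂ (meetings i j i<j) ¬adjacent) (∈∩ x∈gi x∈gj))

  adjacent-meet-once : ∀ {i j} → toℕ i < toℕ j → CycleAdjacent i j →
                       x ∈ g i → x ∈ g j → y ∈ g i → y ∈ g j → x ≡ y
  adjacent-meet-once {i = i} {j} i<j adjacent x∈gi x∈gj y∈gi y∈gj =
    ∣p∣≤1⇒x∈p⇒y∈p⇒x≡y (≤-reflexive (proj₁ (meetings i j i<j) adjacent)) (∈∩ x∈gi x∈gj) (∈∩ y∈gi y∈gj)

  toℕ-last : toℕ (fromℕ a) ≡ a
  toℕ-last = toℕ-fromℕ a

  closing : ∃[ c ] c ∈ g zero ∩ g (fromℕ a)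
  closing = 1≤∣p∣⇒∃∈p (≤-reflexive (sym (proj₁ (meetings zero (fromℕ a) 0<last)
                                              (inj₂ (refl , cong suc toℕ-last)))))
    where
    0<last : 0 < toℕ (fromℕ a)
    0<last = subst (0 <_) (sym toℕ-last) (≤-trans (s≤s z≤n) 2≤a)

  c : Fin n
  c = proj₁ closing

  c∈g₀ : c ∈ g zero
  c∈g₀ = ∈∩ˡ (proj₂ closing)

  c∈g-last : ∀ {j} → toℕ j ≡ a → c ∈ g j
  c∈g-last j≡a = subst (λ j → c ∈ g j) (toℕ-injective (trans toℕ-last (sym j≡a))) (∈∩ʳ (proj₂ closing))

  -- An edge of a loose cycle meets the earlier edges only in one vertex of its predecessor, and
  -- the last edge also in c. So every edge but the last has two vertices outside Old j, and the
  -- last edge has one, which is paired with c.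
  Old : Fin (suc a) → Subset n
  Old j = ⁅ c ⁆ ∪ Earlier g j

  earlier⇒predecessor : ∀ {j} → x ∈ g j → x ∈ Earlier g j →
                        (toℕ j ≡ a × x ≡ c) ⊎ ∃[ i ] toℕ j ≡ suc (toℕ i) × x ∈ g i
  earlier⇒predecessor {j = j} x∈gj x∈E with ∈Earlier⁻ g x∈E
  ... | i , i<j , x∈gi with meet⇒adjacent i<j x∈gi x∈gj
  ...   | inj₁ j≡1+i = inj₂ (i , j≡1+i , x∈gi)
  ...   | inj₂ closes@(i≡0 , 1+j≡1+a) =
    inj₁ (j≡a , adjacent-meet-once i<j (inj₂ closes) x∈gi x∈gj c∈gi (c∈g-last j≡a))
    where
    j≡a : toℕ j ≡ a
    j≡a = suc-injective 1+j≡1+a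
    c∈gi : c ∈ g i
    c∈gi = subst (λ i → c ∈ g i) (toℕ-injective {i = zero} (sym i≡0)) c∈g₀

  same-predecessor : ∀ {i i′ j} → toℕ j ≡ suc (toℕ i) → toℕ j ≡ suc (toℕ i′) →
                     x ∈ g j → y ∈ g j → x ∈ g i → y ∈ g i′ → x ≡ y
  same-predecessor {i = i} j≡1+i j≡1+i′ x∈gj y∈gj x∈gi y∈gi′
    with toℕ-injective {i = i} (suc-injective (trans (sym j≡1+i) j≡1+i′))
  ... | refl = adjacent-meet-once (≤-reflexive (sym j≡1+i)) (inj₁ j≡1+i) x∈gi x∈gj y∈gi′ y∈gj

  not-last : ∀ {j : Fin (suc a)} {Q : Set} → toℕ j < a → (toℕ j ≡ a × x ≡ c) ⊎ Q → Q
  not-last j<a = Sum.[ (λ (j≡a , _) → ⊥-elim (<-irrefl j≡a j<a)) , (λ q → q) ]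

  middle-old : ∀ {j} → toℕ j < a → x ∈ g j → x ∈ Old j →
               (toℕ j ≡ 0 × x ≡ c) ⊎ ∃[ i ] toℕ j ≡ suc (toℕ i) × x ∈ g i
  middle-old {j = j} j<a x∈gj x∈Old with ∈⁅⁆∪⁻ x∈Old | toℕ j ≟ℕ 0
  ... | inj₁ refl | yes j≡0 = inj₁ (j≡0 , refl)
  ... | inj₁ refl | no  j≢0 = inj₂ (not-last j<a (earlier⇒predecessor x∈gj (∈Earlier⁺ g (n≢0⇒n>0 j≢0) c∈g₀)))
  ... | inj₂ x∈E  | _       = inj₂ (not-last j<a (earlier⇒predecessor x∈gj x∈E))

  middle-unique : ∀ {j} → toℕ j < a → x ∈ g j ∩ Old j → y ∈ g j ∩ Old j → x ≡ y
  middle-unique j<a x∈ y∈ with middle-old j<a (∈∩ˡ x∈) (∈∩ʳ x∈) | middle-old j<a (∈∩ˡ y∈) (∈∩ʳ y∈)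
  ... | inj₁ (_ , x≡c)         | inj₁ (_ , y≡c)          = trans x≡c (sym y≡c)
  ... | inj₂ (_ , j≡1+i , x∈gi) | inj₂ (_ , j≡1+i′ , y∈gi′) =
    same-predecessor j≡1+i j≡1+i′ (∈∩ˡ x∈) (∈∩ˡ y∈) x∈gi y∈gi′
  ... | inj₁ (j≡0 , _)         | inj₂ (_ , j≡1+i′ , _)   = case trans (sym j≡0) j≡1+i′ of λ ()
  ... | inj₂ (_ , j≡1+i , _)   | inj₁ (j≡0 , _)          = case trans (sym j≡0) j≡1+i of λ ()

  off-c-unique : ∀ {j} → x ∈ g j ∩ Old j → y ∈ g j ∩ Old j → x ≢ c → y ≢ c → x ≡ y
  off-c-unique x∈ y∈ x≢c y≢c with predecessor x∈ x≢c | predecessor y∈ y≢c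
    where
    predecessor : ∀ {j x} → x ∈ g j ∩ Old j → x ≢ c → ∃[ i ] toℕ j ≡ suc (toℕ i) × x ∈ g i
    predecessor x∈ x≢c with ∈⁅⁆∪⁻ (∈∩ʳ x∈)
    ... | inj₁ x≡c = ⊥-elim (x≢c x≡c)
    ... | inj₂ x∈E with earlier⇒predecessor (∈∩ˡ x∈) x∈E
    ...   | inj₁ (_ , x≡c) = ⊥-elim (x≢c x≡c)
    ...   | inj₂ found     = found
  ... | _ , j≡1+i , x∈gi | _ , j≡1+i′ , y∈gi′ = same-predecessor j≡1+i j≡1+i′ (∈∩ˡ x∈) (∈∩ˡ y∈) x∈gi y∈gi′

  ≮a⇒≡a : ∀ {j : Fin (suc a)} → ¬ toℕ j < a → toℕ j ≡ a
  ≮a⇒≡a {j} j≮a = ≤-antisym (≤-pred (toℕ<n j)) (≮⇒≥ j≮a)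

  record CyclePair (j : Fin (suc a)) (x y : Fin n) : Set where
    field
      fst∈    : x ∈ g j
      snd∈    : y ∈ g j
      fst≢snd : x ≢ y
      fst-new : x ∉ Old j
      snd-new : toℕ j < a → y ∉ Old j
      snd≡c   : toℕ j ≡ a → y ≡ c

  middleNew : ∀ {j} → toℕ j < a → ∃[ x ] ∃[ y ] x ∈ g j × y ∈ g j × x ≢ y × x ∉ Old j × y ∉ Old j
  middleNew {j} j<a = 2+∣s∩O∣≤∣s∣⇒∃₂∈s∖O {s = g j} {O = Old j}
    (≤-trans (+-monoʳ-≤ 2 (unique⇒∣p∣≤1 {p = g j ∩ Old j} (middle-unique j<a))) (3≤∣g∣ j))

  lastNew : ∀ j → ∃[ x ] x ∈ g j × x ∉ Old j
  lastNew j = ∣s∩O∣<∣s∣⇒∃∈s∖O {s = g j} {O = Old j}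
    (≤-<-trans (unique-off⇒∣p∣≤2 {p = g j ∩ Old j} c off-c-unique) (3≤∣g∣ j))

  cyclePair : ∀ j → ∃[ x ] ∃[ y ] CyclePair j x y
  cyclePair j with toℕ j <? a
  ... | yes j<a = middle (middleNew j<a)
    where
    middle : ∃[ x ] ∃[ y ] x ∈ g j × y ∈ g j × x ≢ y × x ∉ Old j × y ∉ Old j → ∃[ x ] ∃[ y ] CyclePair j x y
    middle (x , y , x∈ , y∈ , x≢y , x∉ , y∉) =
      x , y , record { fst∈ = x∈ ; snd∈ = y∈ ; fst≢snd = x≢y ; fst-new = x∉ ; snd-new = λ _ → y∉
                     ; snd≡c = λ j≡a → ⊥-elim (<-irrefl j≡a j<a) }
  ... | no j≮a = last (lastNew j)
    where
    j≡a : toℕ j ≡ a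
    j≡a = ≮a⇒≡a j≮a
    last : ∃[ x ] x ∈ g j × x ∉ Old j → ∃[ x ] ∃[ y ] CyclePair j x y
    last (x , x∈ , x∉) =
      x , c , record { fst∈ = x∈ ; snd∈ = c∈g-last j≡a ; fst≢snd = λ { refl → x∉ (∈∪ˡ (x∈⁅x⁆ c)) }
                     ; fst-new = x∉ ; snd-new = λ j<a → ⊥-elim (j≮a j<a) ; snd≡c = λ _ → refl }

  fst snd : Fin (suc a) → Fin n
  fst j = proj₁ (cyclePair j)
  snd j = proj₁ (proj₂ (cyclePair j))

  spec : ∀ j → CyclePair j (fst j) (snd j)
  spec j = proj₂ (proj₂ (cyclePair j))

  open CyclePair

  InCyclePair : Fin (suc a) → Fin n → Set
  InCyclePair j x = x ≡ fst j ⊎ x ≡ snd j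

  snd-status : ∀ j → Dec (toℕ j < a) → snd j ∉ Old j ⊎ toℕ j ≡ a × snd j ≡ c
  snd-status j (yes j<a) = inj₁ (snd-new (spec j) j<a)
  snd-status j (no  j≮a) = inj₂ (≮a⇒≡a j≮a , snd≡c (spec j) (≮a⇒≡a j≮a))

  inCyclePair⇒new : ∀ {j} → InCyclePair j x → x ∈ g j × (x ∉ Old j ⊎ toℕ j ≡ a × x ≡ c)
  inCyclePair⇒new {j = j} (inj₁ refl) = fst∈ (spec j) , inj₁ (fst-new (spec j))
  inCyclePair⇒new {j = j} (inj₂ refl) = snd∈ (spec j) , snd-status j (toℕ j <? a)

  π : PairFamily n
  π = pairFamily (suc a) fst snd (fst≢snd ∘ spec)
        (λ {i} {j} → apart-byOrder {Active = λ _ → ⊤} {Mem = InCyclePair} later-avoids tt tt)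
    where
    later-avoids : ∀ {i j x} → toℕ i < toℕ j → ⊤ → ⊤ → InCyclePair i x → ¬ InCyclePair j x
    later-avoids {i} {j} i<j _ _ x∈i x∈j with inCyclePair⇒new x∈i | inCyclePair⇒new x∈j
    ... | _ , inj₂ (i≡a , _) | _ = <-irrefl i≡a (<-≤-trans i<j (≤-pred (toℕ<n j)))
    ... | x∈gi , inj₁ x∉Oldi | _ , inj₁ x∉Oldj = x∉Oldj (∈∪ʳ (∈Earlier⁺ g i<j x∈gi))
    ... | _ , inj₁ x∉Oldi | _ , inj₂ (_ , refl) = x∉Oldi (∈∪ˡ (x∈⁅x⁆ c))

  cyclePairing : CorePairing g
  cyclePairing = corePairing π (λ {j} _ → j , fst∈ (spec j) , snd∈ (spec j))
                               (λ j → j , tt , fst∈ (spec j) , snd∈ (spec j))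

looseCycle⇒CorePairing : ∀ {k a} {g : Fin (suc a) → Subset n} → (∀ j → 3 ≤ ∣ g j ∣) →
                         LooseCycle k g → CorePairing g
looseCycle⇒CorePairing 3≤∣g∣ (_ , _ , s≤s 2≤a , meetings) = LooseCycleCore.cyclePairing 3≤∣g∣ 2≤a meetings

module PaschCore {n} (V : Fin n → Set) {g : Fin 4 → Subset n} (core⊆V : ∀ {j x} → x ∈ g j → V x)
  (3≤∣g∣ : ∀ j → 3 ≤ ∣ g j ∣) (meet-once : ∀ i j → i ≢ j → ∣ g i ∩ g j ∣ ≡ 1)
  (two-edges : ∀ w → w ∈ bigUnion g →
     ∃[ i ] ∃[ j ] i ≢ j × w ∈ g i × w ∈ g j × (∀ m → m ≢ i → m ≢ j → w ∉ g m))
  where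

  private module Core = Strategies V (InCore g) (CoreEdge g)

  meet-unique : ∀ {i j} → i ≢ j → x ∈ g i → x ∈ g j → y ∈ g i → y ∈ g j → x ≡ y
  meet-unique {i = i} {j} i≢j x∈gi x∈gj y∈gi y∈gj =
    ∣p∣≤1⇒x∈p⇒y∈p⇒x≡y (≤-reflexive (meet-once i j i≢j)) (∈∩ x∈gi x∈gj) (∈∩ y∈gi y∈gj)

  CorePaired : (σ : PairFamily n) → Set
  CorePaired σ = ∀ {x y} → x ~[ σ ] y → InCore g x × V y

  UntouchedCore : Subset n → Set
  UntouchedCore M = ∀ {x} → InCore g x → x ∉ M

  another-edge : ∀ i → x ∈ g i → ∃[ h ] h ≢ i × x ∈ g h
  another-edge {x = x} i x∈gi with two-edges x (∈bigUnion⁺ {f = g} i x∈gi)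
  ... | i′ , j′ , i′≢j′ , x∈gi′ , x∈gj′ , _ with i′ ≟ i
  ...   | yes refl = j′ , i′≢j′ ∘ sym , x∈gj′
  ...   | no  i′≢i = i′ , i′≢i , x∈gi′

  FirstAnswer : Subset n → Fin n → Set
  FirstAnswer M u = ∃[ r ] V r × r ∉ ⁅ u ⁆ ∪ M × ∃[ σ ] Σ (CorePaired σ) λ σ-pairs →
                      ∀ {K} → r ∈ K → Core.PairingInv σ σ-pairs (⁅ u ⁆ ∪ M) K

  firstCoreMove : UntouchedCore M → InCore g u → FirstAnswer M u
  firstCoreMove {M = M} {u = u} untouched (j₀ , u∈)
    with two-edges u (∈bigUnion⁺ {f = g} j₀ u∈)
  ... | iu , ju , iu≢ju , u∈iu , u∈ju , u-only
    with ∃₂-avoiding u (3≤∣g∣ iu)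
  ... | r , _ , r∈iu , _ , _ , r≢u , _
    with another-edge iu r∈iu
  ... | h , h≢iu , r∈h
    with fourthPoint refl iu ju h iu≢ju (h≢iu ∘ sym)
           (λ { refl → r≢u (meet-unique iu≢ju r∈iu r∈h u∈iu u∈ju) })
  ... | f , f≢iu , f≢ju , f≢h , covers
    with 1≤∣p∣⇒∃∈p (≤-reflexive (sym (meet-once ju f (f≢ju ∘ sym))))
  ... | z₀ , z₀∈
    with ∃-avoiding₂ u z₀ (3≤∣g∣ ju)
  ... | b , b∈ju , b≢u , b≢z₀
    with ∃₂-avoiding z₀ (3≤∣g∣ f)
  ... | c′ , d , c′∈f , d∈f , c′≢d , c′≢z₀ , d≢z₀ =
    r , core⊆V r∈iu , Sum.[ r≢u , untouched (iu , r∈iu) ] ∘ ∈⁅⁆∪⁻ ,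
    σ , σ-pairs , λ r∈K → answered , covered r∈K
    where
    z₀∈ju : z₀ ∈ g ju
    z₀∈ju = ∈∩ˡ z₀∈
    z₀∈f : z₀ ∈ g f
    z₀∈f = ∈∩ʳ z₀∈
    b∉f : b ∉ g f
    b∉f b∈f = b≢z₀ (meet-unique (f≢ju ∘ sym) b∈ju b∈f z₀∈ju z₀∈f)
    first-apart : x ≡ z₀ ⊎ x ≡ b → ¬ (x ≡ c′ ⊎ x ≡ d)
    first-apart (inj₁ refl) (inj₁ refl) = c′≢z₀ refl
    first-apart (inj₁ refl) (inj₂ refl) = d≢z₀ refl
    first-apart (inj₂ refl) (inj₁ refl) = b∉f c′∈f
    first-apart (inj₂ refl) (inj₂ refl) = b∉f d∈f
    σ : PairFamily n
    σ = twoPairs z₀ b c′ d (b≢z₀ ∘ sym) c′≢d first-apart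
    open PairFamily σ using (fst; snd)
    inEdge : ∀ j → ∃[ i ] fst j ∈ g i × snd j ∈ g i
    inEdge zero       = ju , z₀∈ju , b∈ju
    inEdge (suc zero) = f , c′∈f , d∈f
    σ-pairs : CorePaired σ
    σ-pairs x~y with ~-elim σ {R = λ x y → ∃[ i ] x ∈ g i × y ∈ g i} (λ (i , x∈ , y∈) → i , y∈ , x∈)
                           (λ {j} _ → inEdge j) x~y
    ... | i , x∈ , y∈ = (i , x∈) , core⊆V y∈
    paired≢u : ∀ j → fst j ≢ u × snd j ≢ u
    paired≢u zero       = (λ { refl → u-only f f≢iu f≢ju z₀∈f }) , b≢u
    paired≢u (suc zero) = (λ { refl → u-only f f≢iu f≢ju c′∈f }) , (λ { refl → u-only f f≢iu f≢ju d∈f })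
    answered : ∀ {K} → Answered σ (⁅ u ⁆ ∪ M) K
    answered x~y x∈ =
      ⊥-elim (Sum.[ proj₁ (~-elim σ {R = λ x y → x ≢ u × y ≢ u} swap (λ {j} _ → paired≢u j) x~y)
                  , untouched (proj₁ (σ-pairs x~y)) ] (∈⁅⁆∪⁻ x∈))
    covered : ∀ {K} → r ∈ K → ∀ {e} → CoreEdge g e → Core.Covered σ σ-pairs K e
    covered r∈K (m , refl) with covers m
    ... | inj₁ refl                = inj₁ (r , r∈iu , r∈K)
    ... | inj₂ (inj₁ refl)         = inj₂ (z₀ , b , (zero , tt , inj₁ (refl , refl)) , z₀∈ju , b∈ju)
    ... | inj₂ (inj₂ (inj₁ refl))  = inj₁ (r , r∈h , r∈K)
    ... | inj₂ (inj₂ (inj₂ refl))  = inj₂ (c′ , d , (suc zero , tt , inj₁ (refl , refl)) , c′∈f , d∈f)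

  PaschInv : Subset n → Subset n → Set
  PaschInv M K =
    UntouchedCore M ⊎ ∃[ σ ] Σ (CorePaired σ) λ σ-pairs → Core.PairingInv σ σ-pairs M K

  paschCore : Core.CoreStrategy
  paschCore = record
    { Inv                = PaschInv
    ; initial            = inj₁ λ _ → ∉⊥
    ; breakerClaims      = Sum.map₂ λ (σ , σ-pairs , inv) →
                             σ , σ-pairs , Core.pairingInv-breakerClaims σ σ-pairs inv
    ; makerClaimsOutside = λ u∉core → Sum.map (untouched-outside u∉core) λ (σ , σ-pairs , inv) →
                             σ , σ-pairs , Core.pairingInv-makerClaimsOutside σ σ-pairs u∉core inv
    ; coreEdgeBlocked    = blocked
    ; makerClaimsInside  = claimInside
    }
    where
    untouched-outside : ¬ InCore g u → UntouchedCore M → UntouchedCore (⁅ u ⁆ ∪ M)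
    untouched-outside u∉core untouched x∈core x∈ =
      Sum.[ (λ { refl → u∉core x∈core }) , untouched x∈core ] (∈⁅⁆∪⁻ x∈)

    blocked : ∀ {f} → CoreEdge g f → Disjoint M K → PaschInv M K → u ∉ K → ¬ f ⊆ ⁅ u ⁆ ∪ M
    blocked {u = u} (j , refl) _ (inj₁ untouched) _ g⊆ =
      case ≤-trans (3≤∣g∣ j) (unique⇒∣p∣≤1 {p = g j} λ x∈ y∈ → trans (is-u x∈) (sym (is-u y∈)))
        of λ { (s≤s ()) }
      where
      is-u : x ∈ g j → x ≡ u
      is-u x∈ = Sum.[ (λ x≡u → x≡u) , ⊥-elim ∘ untouched (j , x∈) ] (∈⁅⁆∪⁻ (g⊆ x∈))
    blocked f-core M∩K≡∅ (inj₂ (σ , σ-pairs , inv)) =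
      Core.pairingInv-coreEdgeBlocked σ σ-pairs f-core M∩K≡∅ inv

    claimInside : Disjoint M K → PaschInv M K → InCore g u → V u → u ∉ M → u ∉ K →
      (∃[ w ] V w × w ∉ ⁅ u ⁆ ∪ M × w ∉ K × PaschInv (⁅ u ⁆ ∪ M) (⁅ w ⁆ ∪ K)) ⊎ PaschInv (⁅ u ⁆ ∪ M) K
    claimInside {M = M} {K = K} {u = u} _ (inj₁ untouched) u∈core _ _ _ =
      answer (firstCoreMove untouched u∈core)
      where
      answer : FirstAnswer M u →
               (∃[ w ] V w × w ∉ ⁅ u ⁆ ∪ M × w ∉ K × PaschInv (⁅ u ⁆ ∪ M) (⁅ w ⁆ ∪ K)) ⊎ PaschInv (⁅ u ⁆ ∪ M) K
      answer (r , r∈V , r∉ , σ , σ-pairs , inv) with r ∈? K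
      ... | yes r∈K = inj₂ (inj₂ (σ , σ-pairs , inv r∈K))
      ... | no  r∉K = inj₁ (r , r∈V , r∉ , r∉K , inj₂ (σ , σ-pairs , inv (∈∪ˡ (x∈⁅x⁆ r))))
    claimInside M∩K≡∅ (inj₂ (σ , σ-pairs , inv)) _ _ _ u∉K =
      Sum.map (λ (w , w∈V , w∉ , w∉K , inv′) → w , w∈V , w∉ , w∉K , inj₂ (σ , σ-pairs , inv′))
              (λ inv′ → inj₂ (σ , σ-pairs , inv′))
              (Core.pairingInv-makerClaims σ σ-pairs M∩K≡∅ inv u∉K)

pasch⇒CoreStrategy : ∀ {k a} {g : Fin (suc a) → Subset n} (V : Fin n → Set) → (∀ {j x} → x ∈ g j → V x) →
  (∀ j → 3 ≤ ∣ g j ∣) → Pasch k g → CoreStrategy V (InCore g) (CoreEdge g)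
pasch⇒CoreStrategy V core⊆V 3≤∣g∣ (_ , _ , refl , _ , meet-once , two-edges) =
  PaschCore.paschCore V core⊆V 3≤∣g∣ meet-once two-edges

CoreConfigurations : (k a : ℕ) → (Fin (suc a) → Subset n) → List Set
CoreConfigurations k a g =
    (a ≡ 0)
  ∷ (2 ≤ a × LooseCycle k g)
  ∷ (a ≡ 1 × OverlappingPair k g)
  ∷ (a ≡ 3 × k ≡ 3 × Pasch k g)
  ∷ (3 ≤ a × Σ ℕ (λ m → suc a ≡ m + m × DoubleStar k m g))
  ∷ (2 ≤ a × Σ ℕ (λ d → d ≤ floorDiv k a × Link k d g))
  ∷ []

configuration⇒CoreStrategy : ∀ {k a} {g : Fin (suc a) → Subset n} (V : Fin n → Set) →
  (∀ {j x} → x ∈ g j → V x) →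
  3 ≤ k → (∀ j → ∣ g j ∣ ≡ k) → Injective _≡_ _≡_ g → ExactlyOne (CoreConfigurations k a g) →
  CoreStrategy V (InCore g) (CoreEdge g)
configuration⇒CoreStrategy {k = k} {a} {g} V core⊆V 3≤k ∣g∣≡k g-inj = cases
  where
  3≤∣g∣ : ∀ j → 3 ≤ ∣ g j ∣
  3≤∣g∣ j = subst (3 ≤_) (sym (∣g∣≡k j)) 3≤k
  viaPairing : CorePairing g → CoreStrategy V (InCore g) (CoreEdge g)
  viaPairing = corePairing⇒CoreStrategy V core⊆V
  cases : ExactlyOne (CoreConfigurations k a g) → CoreStrategy V (InCore g) (CoreEdge g)
  cases (inj₁ (a≡0 , _)) = viaPairing (oneEdge⇒CorePairing a≡0 (≤-trans (s≤s (s≤s z≤n)) (3≤∣g∣ zero)))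
  cases (inj₂ (_ , inj₁ ((_ , cycle) , _))) = viaPairing (looseCycle⇒CorePairing {k = k} 3≤∣g∣ cycle)
  cases (inj₂ (_ , inj₂ (_ , inj₁ ((_ , pair) , _)))) =
    viaPairing (overlappingPair⇒CorePairing {k = k} pair)
  cases (inj₂ (_ , inj₂ (_ , inj₂ (_ , inj₁ ((_ , _ , pasch) , _))))) =
    pasch⇒CoreStrategy V core⊆V 3≤∣g∣ pasch
  cases (inj₂ (_ , inj₂ (_ , inj₂ (_ , inj₂ (_ , inj₁ ((_ , _ , _ , star) , _)))))) =
    viaPairing (doubleStar⇒CorePairing 3≤∣g∣ star)
  cases (inj₂ (_ , inj₂ (_ , inj₂ (_ , inj₂ (_ , inj₂ (_ , inj₁ ((2≤a , _ , d≤ , link) , _))))))) =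
    viaPairing (link⇒CorePairing 3≤k 2≤a d≤ ∣g∣≡k g-inj link)
  cases (inj₂ (_ , inj₂ (_ , inj₂ (_ , inj₂ (_ , inj₂ (_ , inj₂ (_ , ())))))))

module Component {ℓ k} (3≤k : 3 ≤ k) (B : Matrix ℓ k) (b′ : Fin ℓ → ℤ) {n} (X : Subset n) (v : Fin n)
  {t} (e : Fin (suc t) → Subset n)
  (e-edges : ∀ i → CompEdge B b′ n X v (e i))
  (e-all : ∀ f → CompEdge B b′ n X v f → ∃[ i ] e i ≡ f) where

  V : Fin n → Set
  V = CompVertex B b′ n X v

  E : Subset n → Set
  E = CompEdge B b′ n X v

  Adj : Fin n → Fin n → Set
  Adj = AdjacentH B b′ n X

  ∈e⇒V : ∀ i → x ∈ e i → V x
  ∈e⇒V i = proj₂ (e-edges i) _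

  adjacent⇒inEdge : Star Adj v x → Adj x y → ∃[ i ] x ∈ e i × y ∈ e i
  adjacent⇒inEdge v⇝x (f , f-edge@(xs , xs∈X , _ , _ , f≡) , x∈f , y∈f) with e-all f (f-edge , inComponent)
    where
    inComponent : ∀ u → u ∈ f → V u
    inComponent u u∈f with ∈image⁻ xs (subst (u ∈_) f≡ u∈f)
    ... | j , refl = xs∈X j , v⇝x ◅◅ ((f , f-edge , x∈f , u∈f) ◅ ε)
  ... | i , refl = i , x∈f , y∈f

  ∣e∣≡k : ∀ i → ∣ e i ∣ ≡ k
  ∣e∣≡k i with e-edges i
  ... | (xs , _ , xs-inj , _ , e≡) , _ = trans (cong ∣_∣ e≡) (∣image∣≡k xs xs-inj)

  v∈e : ∃[ i ] v ∈ e i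
  v∈e with 1≤∣p∣⇒∃∈p (≤-trans (≤-trans (s≤s z≤n) 3≤k) (≤-reflexive (sym (∣e∣≡k zero))))
  ... | x₀ , x₀∈e₀ with ∈e⇒V zero x₀∈e₀
  ...   | _ , ε          = zero , x₀∈e₀
  ...   | _ , (v~y ◅ _) = map₂ proj₁ (adjacent⇒inEdge ε v~y)

  reachable⇒inEdge : Star Adj v x → ∃[ i ] x ∈ e i
  reachable⇒inEdge = walk ε v∈e
    where
    walk : Star Adj v x → ∃[ i ] x ∈ e i → Star Adj x y → ∃[ i ] y ∈ e i
    walk v⇝x x∈e ε                 = x∈e
    walk v⇝x _   (x~z ◅ z⇝y) = walk (v⇝x ◅◅ (x~z ◅ ε)) (map₂ proj₂ (adjacent⇒inEdge v⇝x x~z)) z⇝y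

  V⇒∈e : V x → ∃[ i ] x ∈ e i
  V⇒∈e = reachable⇒inEdge ∘ proj₂

  V? : ∀ x → Dec (V x)
  V? x with any? (λ i → x ∈? e i)
  ... | yes (i , x∈e) = yes (∈e⇒V i x∈e)
  ... | no  x∉e       = no (x∉e ∘ V⇒∈e)


  module EdgeOrder {a} (a≤t : a ≤ t) (good : ∀ i → a < toℕ i → Good e i) where

    core : Fin (suc a) → Subset n
    core j = e (inject≤ j (s≤s a≤t))

    ∣core∣≡k : ∀ j → ∣ core j ∣ ≡ k
    ∣core∣≡k j = ∣e∣≡k _

    core-injective : Injective _≡_ _≡_ e → Injective _≡_ _≡_ core
    core-injective e-inj {j} {j′} core≡ = toℕ-injective
      (trans (sym (toℕ-inject≤ j (s≤s a≤t))) (trans (cong toℕ (e-inj core≡)) (toℕ-inject≤ j′ (s≤s a≤t))))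

    NewPair : Fin (suc t) → Fin n → Fin n → Set
    NewPair i x y = x ∈ e i × y ∈ e i × x ≢ y × x ∉ Earlier e i × y ∉ Earlier e i

    newPair : ∀ i → a < toℕ i → ∃[ x ] ∃[ y ] NewPair i x y
    newPair i a<i = 2+∣s∩O∣≤∣s∣⇒∃₂∈s∖O (subst₂ _≤_ (cong (2 +_) (sym (good i a<i))) (sym (∣e∣≡k i)) 3≤k)

    -- the value (v , v) for inactive indices is never used
    treePair : ∀ i → Dec (a < toℕ i) → Fin n × Fin n
    treePair i (yes a<i) = proj₁ (newPair i a<i) , proj₁ (proj₂ (newPair i a<i))
    treePair i (no _)    = v , v

    treePair-new : ∀ i (d : Dec (a < toℕ i)) → a < toℕ i →
                   NewPair i (proj₁ (treePair i d)) (proj₂ (treePair i d))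
    treePair-new i (yes a<i) _   = proj₂ (proj₂ (newPair i a<i))
    treePair-new i (no  a≮i) a<i = ⊥-elim (a≮i a<i)

    treeFst treeSnd : Fin (suc t) → Fin n
    treeFst i = proj₁ (treePair i (a <? toℕ i))
    treeSnd i = proj₂ (treePair i (a <? toℕ i))

    treeFst-treeSnd-new : ∀ {i} → a < toℕ i → NewPair i (treeFst i) (treeSnd i)
    treeFst-treeSnd-new {i} = treePair-new i (a <? toℕ i)

    InTreePair : Fin (suc t) → Fin n → Set
    InTreePair i x = x ≡ treeFst i ⊎ x ≡ treeSnd i

    inTreePair⇒new : ∀ {i} → a < toℕ i → InTreePair i x → x ∈ e i × x ∉ Earlier e i
    inTreePair⇒new a<i x∈ with treeFst-treeSnd-new a<i | x∈
    ... | x∈e , _ , _ , x∉ , _ | inj₁ refl = x∈e , x∉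
    ... | _ , y∈e , _ , _ , y∉ | inj₂ refl = y∈e , y∉

    τ : PairFamily n
    τ = record
      { size    = suc t
      ; active  = λ i → a <ᵇ toℕ i
      ; fst     = treeFst
      ; snd     = treeSnd
      ; fst≢snd = λ {i} a<i → proj₁ (proj₂ (proj₂ (treeFst-treeSnd-new (<ᵇ⇒< a (toℕ i) a<i))))
      ; apart   = apart-byOrder {Active = λ i → T (a <ᵇ toℕ i)} {Mem = InTreePair}
                    λ {i} {j} i<j a<i a<j x∈i x∈j →
                      proj₂ (inTreePair⇒new (<ᵇ⇒< a (toℕ j) a<j) x∈j)
                        (∈Earlier⁺ e i<j (proj₁ (inTreePair⇒new (<ᵇ⇒< a (toℕ i) a<i) x∈i)))
      }

    core-before-tree : ∀ {i : Fin (suc t)} j → a < toℕ i → toℕ (inject≤ j (s≤s a≤t)) < toℕ i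
    core-before-tree j = ≤-<-trans (≤-trans (≤-reflexive (toℕ-inject≤ j (s≤s a≤t))) (≤-pred (toℕ<n j)))

    τ-pairs : x ~[ τ ] y → V y × ¬ InCore core x
    τ-pairs x~y with ~-elim τ {R = SameTreePair} (λ (i , a<i , x∈ , y∈) → i , a<i , y∈ , x∈)
                              (λ {i} a<i → i , <ᵇ⇒< a (toℕ i) a<i , inj₁ refl , inj₂ refl) x~y
      where
      SameTreePair : Fin n → Fin n → Set
      SameTreePair x y = ∃[ i ] a < toℕ i × InTreePair i x × InTreePair i y
    ... | i , a<i , x∈ , y∈ =
      ∈e⇒V i (proj₁ (inTreePair⇒new a<i y∈)) ,
      λ (j , x∈core) → proj₂ (inTreePair⇒new a<i x∈) (∈Earlier⁺ e (core-before-tree j a<i) x∈core)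

    edges : ∀ f → E f → ContainsPair τ f ⊎ CoreEdge core f
    edges f f∈E with e-all f f∈E
    ... | i , refl with a <? toℕ i
    ...   | yes a<i = inj₁ (treeFst i , treeSnd i , (i , <⇒<ᵇ a<i , inj₁ (refl , refl))
                           , proj₁ (inTreePair⇒new a<i (inj₁ refl)) , proj₁ (inTreePair⇒new a<i (inj₂ refl)))
    ...   | no  a≮i = inj₂ (fromℕ< (s≤s (≮⇒≥ a≮i)) , cong e (toℕ-injective
                            (trans (toℕ-inject≤ _ (s≤s a≤t)) (toℕ-fromℕ< (s≤s (≮⇒≥ a≮i))))))

    InCore? : ∀ x → Dec (InCore core x)
    InCore? x = any? (λ j → x ∈? core j)

    breakerWins-withCore : CoreStrategy V (InCore core) (CoreEdge core) → BreakerHasWinningStrategy V E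
    breakerWins-withCore = breakerWins-pairing+core V (InCore core) (CoreEdge core) V? InCore? τ τ-pairs edges

lemma3p3 : (k ℓ : ℕ) → 3 ≤ k → (B : Matrix ℓ k) → Rank B ℓ → Irredundant B
    → StarCondition B → StrictlyBalanced B
    → (b' : Fin ℓ → ℤ) → IrredundantPair B b'
    → (n : ℕ) (X : Subset n) (v : Fin n) → v ∈ X
    → (t : ℕ) (e : Fin (suc t) → Subset n) → Injective _≡_ _≡_ e
    → (∀ i → CompEdge B b' n X v (e i))
    → (∀ f → CompEdge B b' n X v f → Σ (Fin (suc t)) (λ i → e i ≡ f))
    → (a : ℕ) (a≤t : a ≤ t)
    → (∀ i → a < toℕ i → Good e i)
    → ExactlyOne
        ( (a ≡ 0)
        ∷ (2 ≤ a × LooseCycle k (λ (i : Fin (suc a)) → e (inject≤ i (s≤s a≤t))))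
        ∷ (a ≡ 1 × OverlappingPair k (λ (i : Fin (suc a)) → e (inject≤ i (s≤s a≤t))))
        ∷ (a ≡ 3 × k ≡ 3 × Pasch k (λ (i : Fin (suc a)) → e (inject≤ i (s≤s a≤t))))
        ∷ (3 ≤ a × Σ ℕ (λ m → suc a ≡ m + m
              × DoubleStar k m (λ (i : Fin (suc a)) → e (inject≤ i (s≤s a≤t)))))
        ∷ (2 ≤ a × Σ ℕ (λ d → d ≤ floorDiv k a
              × Link k d (λ (i : Fin (suc a)) → e (inject≤ i (s≤s a≤t)))))
        ∷ [])
    → BreakerHasWinningStrategy (CompVertex B b' n X v) (CompEdge B b' n X v)
lemma3p3 k ℓ 3≤k B _ _ _ _ b′ _ n X v _ t e e-inj e-edges e-all a a≤t good configuration =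
  breakerWins-withCore
    (configuration⇒CoreStrategy V (∈e⇒V _) 3≤k ∣core∣≡k (core-injective e-inj) configuration)
  where
  open Component 3≤k B b′ X v e e-edges e-all
  open EdgeOrder a≤t good
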